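{- Let $\mathcal{A}$ be an algebra with two multiplications $\cdot$ and $\ast$ (see context), and let $\kappa$ be the associated cumulants. Let $A_1,\dots,A_n$ be finite multisets of elements of $\mathcal{A}$, $A_i=\{a^i_1,\dots,a^i_{k_i}\}$, and let $A=A_1\cup\cdots\cup A_n$ be their multiset union. Then $$\left(a^1_1\ast\cdots\ast a^1_{k_1}\right)\cdot\,\cdots\,\cdot\left(a^n_1\ast\cdots\ast a^n_{k_n}\right)=\sum_{F\in\overline{\mathcal{F}}(A)}(-1)^{w_F}\,\kappa_F ,$$ where $\overline{\mathcal{F}}(A)$ is the set of reduced mixing forests with leaves in $A$.
   Context: An algebra with two multiplications is a vector space $\mathcal{A}$ over a field with two bilinear products $\cdot$ and $\ast$ such that $(\mathcal{A},\cdot)$ and $(\mathcal{A},\ast)$ are both commutative associative unital algebras. The cumulants are the multilinear maps $\kappa:\mathcal{A}^m\to\mathcal{A}$ ($m\ge1$), symmetric in their arguments, uniquely determined (recursively in $m$) by the moment–cumulant formula $a_1\ast\cdots\ast a_m=\sum_{\nu}\prod_{b\in\nu}\kappa(a_i:i\in b)$ for all $a_1,\dots,a_m\in\mathcal{A}$, where $\nu$ runs over all set partitions of $\{1,\dots,m\}$ and the product over blocks is the $\cdot$-product; in particular $\kappa(a)=a$. The elements $a^i_j$ of the multiset $A$ are regarded as distinguishable (indexed by $(i,j)$) even if equal in $\mathcal{A}$; $a^i_j$ is said to belong to $A_i$. A reduced forest with leaves in $A$ is a finite forest of rooted trees with unordered children whose leaves (vertices with no children; a one-vertex tree consists of a single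 leaf which is also its root) are labelled bijectively by the elements of $A$, and in which every non-leaf vertex has at least two children; forests are taken up to isomorphism of rooted forests preserving leaf labels. For such $F$ define $\kappa_v$ for vertices $v$ inductively: $\kappa_v=a_v$ (the label) if $v$ is a leaf, and $\kappa_v=\kappa(\kappa_{v_1},\dots,\kappa_{v_m})$ if $v$ has children $v_1,\dots,v_m$; then $\kappa_F$ is the $\ast$-product of $\kappa_V$ over all roots $V$ of $F$. $F$ is mixing if for every vertex $v$ all of whose children are leaves, those children are labelled by elements belonging to at least two distinct multisets $A_i\neq A_j$. For a mixing reduced forest, $w_F$ is the number of vertices of $F$ minus the number of leaves. -}

module Defs where

open import Level using (Level; _⊔_) renaming (suc to lsuc)
open import Data.Bool using (Bool; true; false; if_then_else_; not; _∧_)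
open import Data.Bool.ListAction using (all; any)
open import Data.Nat using (ℕ; zero; suc; _≤_)
open import Data.Nat.Properties using ()
open import Data.Fin using (Fin; _≟_)
open import Data.Product using (_×_; _,_; ∃)
open import Data.List using (List; []; _∷_; [_]; map; concatMap; length; foldr; tabulate; allFin; cartesianProductWith)
open import Relation.Nullary using (¬_)
open import Relation.Nullary.Decidable using (⌊_⌋)
open import Algebra.Bundles using (CommutativeRing)
open import Algebra.Module.Bundles using (Module)
open import Algebra.Structures using (IsCommutativeRing)

IsField : ∀ {k kℓ} → CommutativeRing k kℓ → Set (k ⊔ kℓ)
IsField K = (¬ (1# ≈ 0#)) × (∀ x → ¬ (x ≈ 0#) → ∃ λ y → x * y ≈ 1#)
  where open CommutativeRing K

record AlgebraWithTwoMultiplications (k kℓ m mℓ : Level)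
       : Set (lsuc (k ⊔ kℓ ⊔ m ⊔ mℓ)) where
  field
    K        : CommutativeRing k kℓ
    K-field  : IsField K
    V        : Module K m mℓ
  open Module V public
  field
    _·_ : Carrierᴹ → Carrierᴹ → Carrierᴹ
    _∗_ : Carrierᴹ → Carrierᴹ → Carrierᴹ
    1·  : Carrierᴹ
    1∗  : Carrierᴹ
    ·-isCommutativeRing : IsCommutativeRing _≈ᴹ_ _+ᴹ_ _·_ -ᴹ_ 0ᴹ 1·
    ∗-isCommutativeRing : IsCommutativeRing _≈ᴹ_ _+ᴹ_ _∗_ -ᴹ_ 0ᴹ 1∗
    -- compatibility with scalars (with commutativity and distributivity
    -- this gives bilinearity)
    ·-scalar : ∀ r x y → ((r *ₗ x) · y) ≈ᴹ (r *ₗ (x · y))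
    ∗-scalar : ∀ r x y → ((r *ₗ x) ∗ y) ≈ᴹ (r *ₗ (x ∗ y))

-- Combinatorics on lists (list positions are the distinguishable items)

inserts : ∀ {a} {X : Set a} → X → List (List X) → List (List (List X))
inserts x []       = []
inserts x (b ∷ bs) = ((x ∷ b) ∷ bs) ∷ map (b ∷_) (inserts x bs)

partitions : ∀ {a} {X : Set a} → List X → List (List (List X))
partitions []       = [ [] ]
partitions (x ∷ xs) = concatMap (λ p → ([ x ] ∷ p) ∷ inserts x p) (partitions xs)

choices : ∀ {a} {X : Set a} → List (List X) → List (List X)
choices []         = [ [] ]
choices (bs ∷ bss) = cartesianProductWith _∷_ bs (choices bss)

atLeastTwo : ∀ {a} {X : Set a} → List X → Bool
atLeastTwo (_ ∷ _ ∷ _) = true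
atLeastTwo _           = false

-- Rooted trees with unordered children (children listed in a canonical
-- order given by the enumeration) and leaves labelled by X.

data Tree {a} (X : Set a) : Set a where
  leaf : X → Tree X
  node : List (Tree X) → Tree X

-- All reduced trees (non-leaf vertices have ≥ 2 children) whose leaves are
-- labelled bijectively by the items of the list, one per isomorphism
-- class.  A reduced tree on leaf set S is a leaf if |S| = 1, otherwise a
-- root whose children are reduced trees on the blocks of a set partition
-- of S into ≥ 2 blocks.  The ℕ argument is fuel (≥ length suffices).
trees : ∀ {a} {X : Set a} → ℕ → List X → List (Tree X)
trees zero    _             = []
trees (suc f) []            = []
trees (suc f) (x ∷ [])      = [ leaf x ]
trees (suc f) l@(_ ∷ _ ∷ _) =
  concatMap (λ p → if atLeastTwo p then map node (choices (map (trees f) p)) else [])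
            (partitions l)

forests : ∀ {a} {X : Set a} → List X → List (List (Tree X))
forests l = concatMap (λ p → choices (map (trees (length l)) p)) (partitions l)

module _ {a} {X : Set a} where
  mutual
    internal : Tree X → ℕ
    internal (leaf _)  = 0
    internal (node ts) = suc (internalL ts)

    internalL : List (Tree X) → ℕ
    internalL []       = 0
    internalL (t ∷ ts) = internal t Data.Nat.+ internalL ts

  isLeaf : Tree X → Bool
  isLeaf (leaf _) = true
  isLeaf (node _) = false

  wF : List (Tree X) → ℕ
  wF = internalL

-- Mixing: leaves are tagged by the index i of the multiset A_i.

module _ {a} {n : ℕ} {C : Set a} where
  leafTags : List (Tree (Fin n × C)) → List (Fin n)
  leafTags []                     = []
  leafTags (leaf (i , _) ∷ ts)    = i ∷ leafTags ts
  leafTags (node _ ∷ ts)          = leafTags ts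

  twoDistinct : List (Fin n) → Bool
  twoDistinct []       = false
  twoDistinct (i ∷ is) = any (λ j → not ⌊ i ≟ j ⌋) is

  mutual
    mixingT : Tree (Fin n × C) → Bool
    mixingT (leaf _)  = true
    mixingT (node ts) = if all isLeaf ts then twoDistinct (leafTags ts) else mixingL ts

    mixingL : List (Tree (Fin n × C)) → Bool
    mixingL []       = true
    mixingL (t ∷ ts) = mixingT t ∧ mixingL ts

  keepIf : ∀ {b} {Y : Set b} → Bool → Y → List Y
  keepIf true  y = [ y ]
  keepIf false y = []

  mixingForests : List (Fin n × C) → List (List (Tree (Fin n × C)))
  mixingForests l = concatMap (λ F → keepIf (mixingL F) F) (forests l)

  items : (Fin n → List C) → List (Fin n × C)
  items A = concatMap (λ i → map (i ,_) (A i)) (allFin n)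

module Cumulants {k kℓ m mℓ} (𝒜 : AlgebraWithTwoMultiplications k kℓ m mℓ) where
  open AlgebraWithTwoMultiplications 𝒜

  prod· : List Carrierᴹ → Carrierᴹ
  prod· = foldr _·_ 1·

  prod∗ : List Carrierᴹ → Carrierᴹ
  prod∗ = foldr _∗_ 1∗

  sumᴹ : List Carrierᴹ → Carrierᴹ
  sumᴹ = foldr _+ᴹ_ 0ᴹ

  signed : ℕ → Carrierᴹ → Carrierᴹ
  signed zero    x = x
  signed (suc w) x = -ᴹ (signed w x)

  -- κ (on lists of arguments) satisfies the moment–cumulant formula
  -- a_1 ∗ ⋯ ∗ a_m = Σ_ν Π·_{b ∈ ν} κ(a_i : i ∈ b) for all m ≥ 1;
  -- this determines κ uniquely.
  IsCumulant : (List Carrierᴹ → Carrierᴹ) → Set (m ⊔ mℓ)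
  IsCumulant κ = ∀ (l : List Carrierᴹ) → 1 ≤ length l →
    prod∗ l ≈ᴹ sumᴹ (map (λ ν → prod· (map κ ν)) (partitions l))

  module _ (κ : List Carrierᴹ → Carrierᴹ) {b} {X : Set b} (lab : X → Carrierᴹ) where
    mutual
      κᵥ : Tree X → Carrierᴹ
      κᵥ (leaf x)  = lab x
      κᵥ (node ts) = κ (κL ts)

      κL : List (Tree X) → List Carrierᴹ
      κL []       = []
      κL (t ∷ ts) = κᵥ t ∷ κL ts

    κF : List (Tree X) → Carrierᴹ
    κF F = prod∗ (κL F)

module Submission where

-- Tag every element by the index of its multiset and let w C = κ(C) if the
-- items of C come from one multiset, 0 otherwise.  Both sides equal the
-- partition sum  ∑_{ν ⊢ items} ∏_{b ∈ ν} w b  in (𝒜, +, ·).  Left: each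
-- ∗-product is a partition sum of κ (moment–cumulant formula), and since w
-- kills blocks meeting two multisets the partition sum factors.  Right: a
-- forest is a partition into reduced trees; expanding the ∗-product of the
-- roots by the moment–cumulant formula and regrouping leaves, per block, a
-- sum over reduced trees on it in which a new root cancels its children
-- unless they are all leaves.

open import Level using (Level; _⊔_)
open import Function using (id; _∘′_)
open import Function.Bundles using (Equivalence)
open import Algebra.Bundles using (CommutativeSemiring; CommutativeRing)
open import Algebra.Structures using (IsCommutativeMonoid; IsCommutativeSemiring; IsCommutativeRing)
open import Algebra.Structures.Biased using (isCommutativeSemiringˡ)
open import Relation.Binary.Structures using (IsEquivalence)
open import Relation.Binary.PropositionalEquality as ≡ using (_≡_; _≢_)
open import Relation.Nullary using (¬_; yes; no)
open import Relation.Nullary.Decidable using (⌊_⌋; fromWitnessFalse; isYes≗does; dec-true)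
open import Data.Empty using (⊥)
open import Data.Unit using (⊤; tt)
open import Data.Bool using (Bool; true; false; not; if_then_else_; _∧_)
open import Data.Bool.Properties using (T-≡)
open import Data.Bool.ListAction using (all; any)
open import Data.Product using (_×_; _,_; proj₁; proj₂; <_,_>)
import Data.Nat as ℕ
open import Data.Nat using (ℕ; zero; suc; _≤_; _<_; s≤s; z≤n)
open import Data.Nat.Properties using (m≤n⇒m≤1+n; +-suc; m≤m+n; m≤n⇒m≤o+n; m<m+n; ≤-trans; ≤-pred)
open import Data.Nat.ListAction using (sum)
import Data.Fin as Fin
open import Data.Fin using (Fin; _≟_)
open import Data.List
  using (List; []; _∷_; [_]; map; concat; concatMap; tabulate; allFin; _++_; cartesianProductWith; length)
open import Data.List.Properties
  using (map-tabulate; map-id; map-∘; map-cong-local; concatMap-map; concatMap-cong; map-concatMap)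
open import Data.List.Relation.Unary.All as All using (All; []; _∷_)
open import Data.List.Relation.Unary.All.Properties using (map⁺; concat⁺; ++⁺)
open import Data.List.Relation.Unary.Any as Any using (Any; here; there)
open import Data.List.Relation.Unary.Any.Properties using (any⁺) renaming (map⁺ to Any-map⁺)
open import Data.List.Relation.Unary.AllPairs.Core using (_∷_)
open import Data.List.Relation.Unary.Unique.Propositional using (Unique)
open import Data.List.Relation.Unary.Unique.Propositional.Properties using (allFin⁺)
open import Defs

private variable
  a : Level
  A B Z X : Set a

module ListSums {c ℓ} (S : CommutativeSemiring c ℓ) where
  open CommutativeSemiring S public
  open import Relation.Binary.Reasoning.Setoid setoid public
  open import Algebra.Properties.CommutativeSemigroup +-commutativeSemigroup
    using () renaming (interchange to +-interchange) public
  open import Algebra.Properties.CommutativeSemigroup *-commutativeSemigroup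
    using (x∙yz≈y∙xz) renaming (interchange to *-interchange) public

  ∑ : List A → (A → Carrier) → Carrier
  ∑ []       f = 0#
  ∑ (x ∷ xs) f = f x + ∑ xs f

  ∏ : List A → (A → Carrier) → Carrier
  ∏ []       f = 1#
  ∏ (x ∷ xs) f = f x * ∏ xs f

  when : Bool → Carrier → Carrier
  when true  x = x
  when false x = 0#

  ∑-cong : ∀ (xs : List A) {f g : A → Carrier} → (∀ x → f x ≈ g x) → ∑ xs f ≈ ∑ xs g
  ∑-cong []       f≈g = refl
  ∑-cong (x ∷ xs) f≈g = +-cong (f≈g x) (∑-cong xs f≈g)

  ∑-congᴬ : ∀ {xs : List A} {f g : A → Carrier} → All (λ x → f x ≈ g x) xs → ∑ xs f ≈ ∑ xs g
  ∑-congᴬ []       = refl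
  ∑-congᴬ (h ∷ hs) = +-cong h (∑-congᴬ hs)

  ∏-cong : ∀ (xs : List A) {f g : A → Carrier} → (∀ x → f x ≈ g x) → ∏ xs f ≈ ∏ xs g
  ∏-cong []       f≈g = refl
  ∏-cong (x ∷ xs) f≈g = *-cong (f≈g x) (∏-cong xs f≈g)

  ∏-congᴬ : ∀ {xs : List A} {f g : A → Carrier} → All (λ x → f x ≈ g x) xs → ∏ xs f ≈ ∏ xs g
  ∏-congᴬ []       = refl
  ∏-congᴬ (h ∷ hs) = *-cong h (∏-congᴬ hs)

  ∑-zeroᴬ : ∀ {xs : List A} {f : A → Carrier} → All (λ x → f x ≈ 0#) xs → ∑ xs f ≈ 0#
  ∑-zeroᴬ []       = refl
  ∑-zeroᴬ (h ∷ hs) = trans (+-cong h (∑-zeroᴬ hs)) (+-identityˡ _)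

  ∑-zero : ∀ (xs : List A) → ∑ xs (λ _ → 0#) ≈ 0#
  ∑-zero xs = ∑-zeroᴬ (All.universal (λ _ → refl) xs)

  ∑-+ : ∀ (xs : List A) (f g : A → Carrier) → ∑ xs (λ x → f x + g x) ≈ ∑ xs f + ∑ xs g
  ∑-+ []       f g = sym (+-identityˡ _)
  ∑-+ (x ∷ xs) f g = trans (+-cong refl (∑-+ xs f g)) (+-interchange _ _ _ _)

  ∑-*ˡ : ∀ (xs : List A) (y : Carrier) (f : A → Carrier) → y * ∑ xs f ≈ ∑ xs (λ x → y * f x)
  ∑-*ˡ []       y f = zeroʳ y
  ∑-*ˡ (x ∷ xs) y f = trans (distribˡ _ _ _) (+-cong refl (∑-*ˡ xs y f))

  ∑-*ʳ : ∀ (xs : List A) (y : Carrier) (f : A → Carrier) → ∑ xs f * y ≈ ∑ xs (λ x → f x * y)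
  ∑-*ʳ xs y f = trans (*-comm _ _) (trans (∑-*ˡ xs y f) (∑-cong xs (λ _ → *-comm _ _)))

  ∑-++ : ∀ (xs ys : List A) (f : A → Carrier) → ∑ (xs ++ ys) f ≈ ∑ xs f + ∑ ys f
  ∑-++ []       ys f = sym (+-identityˡ _)
  ∑-++ (x ∷ xs) ys f = trans (+-cong refl (∑-++ xs ys f)) (sym (+-assoc _ _ _))

  ∑-map : ∀ (xs : List A) (g : A → B) (f : B → Carrier) → ∑ (map g xs) f ≡ ∑ xs (λ x → f (g x))
  ∑-map []       g f = ≡.refl
  ∑-map (x ∷ xs) g f = ≡.cong (f (g x) +_) (∑-map xs g f)

  ∏-map : ∀ (xs : List A) (g : A → B) (f : B → Carrier) → ∏ (map g xs) f ≡ ∏ xs (λ x → f (g x))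
  ∏-map []       g f = ≡.refl
  ∏-map (x ∷ xs) g f = ≡.cong (f (g x) *_) (∏-map xs g f)

  ∑-concatMap : ∀ (xs : List A) (g : A → List B) (f : B → Carrier) →
                ∑ (concatMap g xs) f ≈ ∑ xs (λ x → ∑ (g x) f)
  ∑-concatMap []       g f = refl
  ∑-concatMap (x ∷ xs) g f = trans (∑-++ (g x) _ f) (+-cong refl (∑-concatMap xs g f))

  ∑-cartesian : ∀ (h : A → B → Z) (xs : List A) (ys : List B) (f : Z → Carrier) →
                ∑ (cartesianProductWith h xs ys) f ≈ ∑ xs (λ x → ∑ ys (λ y → f (h x y)))
  ∑-cartesian h []       ys f = refl
  ∑-cartesian h (x ∷ xs) ys f =
    trans (∑-++ (map (h x) ys) _ f) (+-cong (reflexive (∑-map ys (h x) f)) (∑-cartesian h xs ys f))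

  ∑-swap : ∀ (xs : List A) (ys : List B) (f : A → B → Carrier) →
           ∑ xs (λ x → ∑ ys (f x)) ≈ ∑ ys (λ y → ∑ xs (λ x → f x y))
  ∑-swap []       ys f = sym (∑-zero ys)
  ∑-swap (x ∷ xs) ys f = trans (+-cong refl (∑-swap xs ys f)) (sym (∑-+ ys (f x) _))

  ∏-* : ∀ (xs : List A) (f g : A → Carrier) → ∏ xs (λ x → f x * g x) ≈ ∏ xs f * ∏ xs g
  ∏-* []       f g = sym (*-identityˡ _)
  ∏-* (x ∷ xs) f g = trans (*-cong refl (∏-* xs f g)) (*-interchange _ _ _ _)

  when-cong : ∀ b {x y} → x ≈ y → when b x ≈ when b y
  when-cong true  x≈y = x≈y
  when-cong false x≈y = refl

  when-∑ : ∀ b (xs : List A) (f : A → Carrier) → ∑ xs (λ x → when b (f x)) ≈ when b (∑ xs f)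
  when-∑ true  xs f = refl
  when-∑ false xs f = ∑-zero xs

  when-+ : ∀ b x y → when b x + when b y ≈ when b (x + y)
  when-+ true  x y = refl
  when-+ false x y = +-identityˡ _

  when-comm : ∀ b b′ x → when b (when b′ x) ≈ when b′ (when b x)
  when-comm true  b′    x = refl
  when-comm false true  x = refl
  when-comm false false x = refl

  when-split : ∀ b x → x ≈ when b x + when (not b) x
  when-split true  x = sym (+-identityʳ _)
  when-split false x = sym (+-identityˡ _)

NonEmpty : List A → Set
NonEmpty []      = ⊥
NonEmpty (_ ∷ _) = ⊤

QBlock : ∀ {q} {X : Set a} → (X → Set q) → List X → Set (a ⊔ q)
QBlock Q b = NonEmpty b × All Q b

all-concatMap : ∀ {p} {P : B → Set p} {f : A → List B} {xs : List A} →
                All (λ x → All P (f x)) xs → All P (concatMap f xs)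
all-concatMap = concat⁺ ∘′ map⁺

inserts-QBlocks : ∀ {q} {Q : X → Set q} {x : X} → Q x → (ν : List (List X)) → All (QBlock Q) ν →
                  All (All (QBlock Q)) (inserts x ν)
inserts-QBlocks qx []      []                  = []
inserts-QBlocks qx (b ∷ ν) ((ne , qb) ∷ qν) =
  ((tt , qx ∷ qb) ∷ qν) ∷ map⁺ (All.map ((ne , qb) ∷_) (inserts-QBlocks qx ν qν))

partitions-QBlocks : ∀ {q} {Q : X → Set q} (l : List X) → All Q l → All (All (QBlock Q)) (partitions l)
partitions-QBlocks []      []        = [] ∷ []
partitions-QBlocks (x ∷ l) (qx ∷ ql) =
  all-concatMap (All.map (λ {ν} qν → ((tt , qx ∷ []) ∷ qν) ∷ inserts-QBlocks qx ν qν)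
                         (partitions-QBlocks l ql))

partitions-nonemptyBlocks : ∀ (l : List X) → All (All NonEmpty) (partitions l)
partitions-nonemptyBlocks l =
  All.map (All.map proj₁) (partitions-QBlocks {Q = λ _ → ⊤} l (All.universal (λ _ → tt) l))

inserts-nonempty : ∀ (x : X) (ν : List (List X)) → All NonEmpty (inserts x ν)
inserts-nonempty x []      = []
inserts-nonempty x (b ∷ ν) = tt ∷ map⁺ (All.universal (λ _ → tt) (inserts x ν))

partitions-nonempty : ∀ (x : X) (xs : List X) → All NonEmpty (partitions (x ∷ xs))
partitions-nonempty x xs = all-concatMap (All.universal (λ ν → tt ∷ inserts-nonempty x ν) (partitions xs))

inserts-map : ∀ (f : A → B) (x : A) (ν : List (List A)) →
              inserts (f x) (map (map f) ν) ≡ map (map (map f)) (inserts x ν)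
inserts-map f x []      = ≡.refl
inserts-map f x (b ∷ ν) = ≡.cong (((f x ∷ map f b) ∷ map (map f) ν) ∷_) (begin
  map (map f b ∷_) (inserts (f x) (map (map f) ν))     ≡⟨ ≡.cong (map (map f b ∷_)) (inserts-map f x ν) ⟩
  map (map f b ∷_) (map (map (map f)) (inserts x ν))   ≡⟨ map-∘ (inserts x ν) ⟨
  map (λ μ → map f b ∷ map (map f) μ) (inserts x ν)    ≡⟨ map-∘ (inserts x ν) ⟩
  map (map (map f)) (map (b ∷_) (inserts x ν))         ∎)
  where open ≡.≡-Reasoning

partitions-map : ∀ (f : A → B) (l : List A) → partitions (map f l) ≡ map (map (map f)) (partitions l)
partitions-map f []      = ≡.refl
partitions-map {A = A} {B = B} f (x ∷ l) = begin
  concatMap step (partitions (map f l))                      ≡⟨ ≡.cong (concatMap step) (partitions-map f l) ⟩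
  concatMap step (map (map (map f)) (partitions l))          ≡⟨ concatMap-map step _ (partitions l) ⟩
  concatMap (step ∘′ map (map f)) (partitions l)             ≡⟨ concatMap-cong step-map (partitions l) ⟩
  concatMap (map (map (map f)) ∘′ step′) (partitions l)      ≡⟨ map-concatMap _ step′ (partitions l) ⟨
  map (map (map f)) (concatMap step′ (partitions l))         ∎
  where
  open ≡.≡-Reasoning
  step : List (List B) → List (List (List B))
  step ν = ([ f x ] ∷ ν) ∷ inserts (f x) ν
  step′ : List (List A) → List (List (List A))
  step′ ν = ([ x ] ∷ ν) ∷ inserts x ν
  step-map : ∀ ν → step (map (map f) ν) ≡ map (map (map f)) (step′ ν)
  step-map ν = ≡.cong (([ f x ] ∷ map (map f) ν) ∷_) (inserts-map f x ν)

size : List (List X) → ℕ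
size ν = sum (map length ν)

partitions-size : ∀ (l : List X) → All (λ ν → size ν ≡ length l) (partitions l)
partitions-size []      = ≡.refl ∷ []
partitions-size (x ∷ l) =
  all-concatMap (All.map (λ {ν} eq → ≡.cong suc eq ∷ All.map (λ e → ≡.trans e (≡.cong suc eq)) (inserts-size ν))
                         (partitions-size l))
  where
  inserts-size : ∀ ν → All (λ μ → size μ ≡ suc (size ν)) (inserts x ν)
  inserts-size []      = []
  inserts-size (b ∷ ν) =
    ≡.refl ∷ map⁺ (All.map (λ eq → ≡.trans (≡.cong (length b ℕ.+_) eq) (+-suc _ _)) (inserts-size ν))

block-≤-size : ∀ (ν : List (List X)) → All (λ b → length b ≤ size ν) ν
block-≤-size []      = []
block-≤-size (b ∷ ν) = m≤m+n (length b) (size ν) ∷ All.map (m≤n⇒m≤o+n (length b)) (block-≤-size ν)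

block-<-size : ∀ (ν : List (List X)) → All NonEmpty ν → atLeastTwo ν ≡ true →
               All (λ b → length b < size ν) ν
block-<-size []                               _                  ()
block-<-size (_ ∷ [])                         _                  ()
block-<-size ([] ∷ _ ∷ _)                     (() ∷ _)           _
block-<-size (_ ∷ [] ∷ _)                     (_ ∷ () ∷ _)       _
block-<-size (b@(_ ∷ bs) ∷ b′@(_ ∷ _) ∷ ν) _ _ =
  m<m+n (length b) (s≤s z≤n)
    ∷ All.map (λ c≤ → s≤s (m≤n⇒m≤o+n (length bs) c≤)) (block-≤-size (b′ ∷ ν))

trees-fuel : ∀ (f f′ : ℕ) (l : List X) → length l ≤ f → length l ≤ f′ → trees f l ≡ trees f′ l
trees-fuel zero    zero     []              _       _        = ≡.refl
trees-fuel zero    (suc f′) []              _       _        = ≡.refl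
trees-fuel (suc f) zero     []              _       _        = ≡.refl
trees-fuel (suc f) (suc f′) []              _       _        = ≡.refl
trees-fuel (suc f) (suc f′) (_ ∷ [])        _       _        = ≡.refl
trees-fuel (suc f) (suc f′) l@(_ ∷ _ ∷ _) (s≤s l≤f) (s≤s l≤f′) =
  ≡.cong concat (map-cong-local (All.map (λ {ν} (ne , sz) → same-branch ν ne sz)
    (All.zip (partitions-nonemptyBlocks l , partitions-size l))))
  where
  same-branch : ∀ ν → All NonEmpty ν → size ν ≡ length l →
    (if atLeastTwo ν then map node (choices (map (trees f) ν)) else [])
      ≡ (if atLeastTwo ν then map node (choices (map (trees f′) ν)) else [])
  same-branch ν ne sz with atLeastTwo ν in two
  ... | false = ≡.refl
  ... | true  = ≡.cong (λ ts → map node (choices ts)) (map-cong-local (All.map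
          (λ {b} b< → let b≤ = ≤-pred (≡.subst (length b <_) sz b<)
                      in trees-fuel f f′ b (≤-trans b≤ l≤f) (≤-trans b≤ l≤f′))
          (block-<-size ν ne two)))

trees-nodes : ∀ (f : ℕ) (x y : X) (r : List X) → All (λ t → isLeaf t ≡ false) (trees f (x ∷ y ∷ r))
trees-nodes zero    x y r = []
trees-nodes (suc f) x y r = all-concatMap (All.universal branch (partitions (x ∷ y ∷ r)))
  where
  branch : ∀ ν → All (λ t → isLeaf t ≡ false)
                     (if atLeastTwo ν then map node (choices (map (trees f) ν)) else [])
  branch ν with atLeastTwo ν
  ... | false = []
  ... | true  = map⁺ (All.universal (λ _ → ≡.refl) (choices (map (trees f) ν)))

inserts-atLeastTwo : ∀ (x : X) (ν : List (List X)) →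
                     All (λ μ → atLeastTwo μ ≡ atLeastTwo ν) (inserts x ν)
inserts-atLeastTwo x []           = []
inserts-atLeastTwo x (b ∷ [])     = ≡.refl ∷ []
inserts-atLeastTwo x (b ∷ b′ ∷ ν) = ≡.refl ∷ map⁺ (All.map two (inserts-nonempty x (b′ ∷ ν)))
  where
  two : ∀ {μ} → NonEmpty μ → atLeastTwo (b ∷ μ) ≡ true
  two {_ ∷ _} _ = ≡.refl

allSingletons : List (List X) → Bool
allSingletons []                  = true
allSingletons ([] ∷ ν)            = false
allSingletons ((_ ∷ []) ∷ ν)      = allSingletons ν
allSingletons ((_ ∷ _ ∷ _) ∷ ν)   = false

heads : List (List X) → List X
heads []             = []
heads ([] ∷ ν)       = heads ν
heads ((x ∷ _) ∷ ν)  = x ∷ heads ν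

heads-singletons : ∀ (l : List X) → heads (map [_] l) ≡ l
heads-singletons []      = ≡.refl
heads-singletons (x ∷ l) = ≡.cong (x ∷_) (heads-singletons l)

inserts-notSingletons : ∀ (x : X) (ν : List (List X)) → All NonEmpty ν →
                        All (λ μ → allSingletons μ ≡ false) (inserts x ν)
inserts-notSingletons x []             _        = []
inserts-notSingletons x ((y ∷ b) ∷ ν) (_ ∷ ne) =
  ≡.refl ∷ map⁺ (All.map (keep b) (inserts-notSingletons x ν ne))
  where
  keep : ∀ b {μ} → allSingletons μ ≡ false → allSingletons ((y ∷ b) ∷ μ) ≡ false
  keep []      eq = eq
  keep (_ ∷ _) eq = ≡.refl

choices-nonempty : ∀ (bss : List (List A)) → NonEmpty bss → All NonEmpty (choices bss)
choices-nonempty (bs ∷ bss) _ = go bs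
  where
  go : ∀ bs → All NonEmpty (cartesianProductWith _∷_ bs (choices bss))
  go []       = []
  go (t ∷ bs) = ++⁺ (map⁺ (All.universal (λ _ → tt) (choices bss))) (go bs)

-- The dual numbers S[ε]/(ε²) over S, written as pairs (a , b) = a + bε.
-- They carry the "derivative" bookkeeping: the ε-part of a product
-- ∏ (a_i + b_i ε) is ∑_i b_i ∏_{j≠i} a_j, i.e. a sum over the ways of
-- marking exactly one factor.
module DualNumbers {c ℓ} (S : CommutativeSemiring c ℓ) where
  open CommutativeSemiring S
  open import Algebra.Solver.Ring.NaturalCoefficients.Default S
    using (solve; _:=_; _:+_; _:*_; con)

  infix 4 _≈ᴰ_
  infixl 6 _+ᴰ_
  infixl 7 _*ᴰ_

  _≈ᴰ_ : Carrier × Carrier → Carrier × Carrier → Set ℓ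
  (a , b) ≈ᴰ (a′ , b′) = (a ≈ a′) × (b ≈ b′)

  _+ᴰ_ _*ᴰ_ : Carrier × Carrier → Carrier × Carrier → Carrier × Carrier
  (a , b) +ᴰ (a′ , b′) = (a + a′ , b + b′)
  (a , b) *ᴰ (a′ , b′) = (a * a′ , a * b′ + b * a′)

  ≈ᴰ-isEquivalence : IsEquivalence _≈ᴰ_
  ≈ᴰ-isEquivalence = record
    { refl  = refl , refl
    ; sym   = λ (p , q) → sym p , sym q
    ; trans = λ (p , q) (p′ , q′) → trans p p′ , trans q q′ }

  +ᴰ-isCommutativeMonoid : IsCommutativeMonoid _≈ᴰ_ _+ᴰ_ (0# , 0#)
  +ᴰ-isCommutativeMonoid = record
    { isMonoid = record
      { isSemigroup = record
        { isMagma = record { isEquivalence = ≈ᴰ-isEquivalence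
                           ; ∙-cong = λ (p , q) (p′ , q′) → +-cong p p′ , +-cong q q′ }
        ; assoc = λ _ _ _ → +-assoc _ _ _ , +-assoc _ _ _ }
      ; identity = (λ _ → +-identityˡ _ , +-identityˡ _) , (λ _ → +-identityʳ _ , +-identityʳ _) }
    ; comm = λ _ _ → +-comm _ _ , +-comm _ _ }

  *ᴰ-isCommutativeMonoid : IsCommutativeMonoid _≈ᴰ_ _*ᴰ_ (1# , 0#)
  *ᴰ-isCommutativeMonoid = record
    { isMonoid = record
      { isSemigroup = record
        { isMagma = record
          { isEquivalence = ≈ᴰ-isEquivalence
          ; ∙-cong = λ (p , q) (p′ , q′) → *-cong p p′ , +-cong (*-cong p q′) (*-cong q p′) }
        ; assoc = λ (a , b) (c , d) (e , f) → *-assoc _ _ _ ,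
            solve 6 (λ a b c d e f → (a :* c) :* f :+ (a :* d :+ b :* c) :* e
                                   := a :* (c :* f :+ d :* e) :+ b :* (c :* e)) refl a b c d e f }
      ; identity = (λ (a , b) → *-identityˡ _ ,
                      solve 2 (λ a b → con 1 :* b :+ con 0 :* a := b) refl a b)
                 , (λ (a , b) → *-identityʳ _ ,
                      solve 2 (λ a b → a :* con 0 :+ b :* con 1 := b) refl a b) }
    ; comm = λ (a , b) (c , d) → *-comm _ _ ,
        solve 4 (λ a b c d → a :* d :+ b :* c := c :* b :+ d :* a) refl a b c d }

  abstract
    isCommutativeSemiringᴰ : IsCommutativeSemiring _≈ᴰ_ _+ᴰ_ _*ᴰ_ (0# , 0#) (1# , 0#)
    isCommutativeSemiringᴰ = isCommutativeSemiringˡ (record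
      { +-isCommutativeMonoid = +ᴰ-isCommutativeMonoid
      ; *-isCommutativeMonoid = *ᴰ-isCommutativeMonoid
      ; distribʳ = λ (a , b) (c , d) (e , f) → distribʳ _ _ _ ,
          solve 6 (λ a b c d e f → (c :+ e) :* b :+ (d :+ f) :* a
                                 := (c :* b :+ d :* a) :+ (e :* b :+ f :* a)) refl a b c d e f
      ; zeroˡ = λ (a , b) → zeroˡ _ ,
          solve 2 (λ a b → con 0 :* b :+ con 0 :* a := con 0) refl a b })

  dualSemiring : CommutativeSemiring c ℓ
  dualSemiring = record { isCommutativeSemiring = isCommutativeSemiringᴰ }

Dual : ∀ {c ℓ} → CommutativeSemiring c ℓ → CommutativeSemiring c ℓ
Dual S = DualNumbers.dualSemiring S

partitionSum : ∀ {c ℓ} (S : CommutativeSemiring c ℓ) →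
               (List X → CommutativeSemiring.Carrier S) → List X → CommutativeSemiring.Carrier S
partitionSum S w l = ∑ (partitions l) (λ ν → ∏ ν w)
  where open ListSums S

-- Inserting the new item x into
-- one block of a partition of xs
-- is "differentiating" the product of block weights in direction
-- b ↦ w (x ∷ b); the dual numbers turn this into an algebraic identity.
module PartitionSums {c ℓ} (S : CommutativeSemiring c ℓ) where
  open ListSums S
  private module D = ListSums (Dual S)

  proj₁-∑ : ∀ (xs : List A) (f : A → D.Carrier) → proj₁ (D.∑ xs f) ≈ ∑ xs (proj₁ ∘′ f)
  proj₁-∑ []       f = refl
  proj₁-∑ (x ∷ xs) f = +-cong refl (proj₁-∑ xs f)

  proj₂-∑ : ∀ (xs : List A) (f : A → D.Carrier) → proj₂ (D.∑ xs f) ≈ ∑ xs (proj₂ ∘′ f)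
  proj₂-∑ []       f = refl
  proj₂-∑ (x ∷ xs) f = +-cong refl (proj₂-∑ xs f)

  proj₁-∏ : ∀ (xs : List A) (f : A → D.Carrier) → proj₁ (D.∏ xs f) ≈ ∏ xs (proj₁ ∘′ f)
  proj₁-∏ []       f = refl
  proj₁-∏ (x ∷ xs) f = *-cong refl (proj₁-∏ xs f)

  proj₁-partitionSum : ∀ (l : List X) (f : List X → D.Carrier) →
                       proj₁ (partitionSum (Dual S) f l) ≈ partitionSum S (proj₁ ∘′ f) l
  proj₁-partitionSum l f = trans (proj₁-∑ (partitions l) _) (∑-cong (partitions l) (λ ν → proj₁-∏ ν f))

  proj₂-partitionSum : ∀ (l : List X) (f : List X → D.Carrier) →
                       proj₂ (partitionSum (Dual S) f l) ≈ ∑ (partitions l) (λ ν → proj₂ (D.∏ ν f))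
  proj₂-partitionSum l f = proj₂-∑ (partitions l) _

  inserts-∏ : ∀ (x : X) (ν : List (List X)) (w : List X → Carrier) →
              ∑ (inserts x ν) (λ μ → ∏ μ w) ≈ proj₂ (D.∏ ν < w , (λ b → w (x ∷ b)) >)
  inserts-∏ x []      w = refl
  inserts-∏ {X = X} x (b ∷ ν) w = begin
    w (x ∷ b) * ∏ ν w + ∑ (map (b ∷_) (inserts x ν)) (λ μ → ∏ μ w)
      ≈⟨ +-cong refl (reflexive (∑-map (inserts x ν) (b ∷_) _)) ⟩
    w (x ∷ b) * ∏ ν w + ∑ (inserts x ν) (λ μ → w b * ∏ μ w)
      ≈⟨ +-cong refl (sym (∑-*ˡ (inserts x ν) (w b) _)) ⟩
    w (x ∷ b) * ∏ ν w + w b * ∑ (inserts x ν) (λ μ → ∏ μ w)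
      ≈⟨ +-cong (*-cong refl (sym (proj₁-∏ ν wε))) (*-cong refl (inserts-∏ x ν w)) ⟩
    w (x ∷ b) * proj₁ (D.∏ ν wε) + w b * proj₂ (D.∏ ν wε)
      ≈⟨ +-comm _ _ ⟩
    w b * proj₂ (D.∏ ν wε) + w (x ∷ b) * proj₁ (D.∏ ν wε) ∎
    where
    wε : List X → D.Carrier
    wε = < w , (λ b → w (x ∷ b)) >

  -- First-item recursion: either x forms a singleton block, or it is
  -- inserted into a block of a partition of xs.
  partitionSum-cons : ∀ (x : X) (xs : List X) (w : List X → Carrier) →
    partitionSum S w (x ∷ xs)
      ≈ w [ x ] * partitionSum S w xs
        + proj₂ (partitionSum (Dual S) < w , (λ b → w (x ∷ b)) > xs)
  partitionSum-cons {X = X} x xs w = begin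
    ∑ (concatMap (λ ν → ([ x ] ∷ ν) ∷ inserts x ν) (partitions xs)) (λ ν → ∏ ν w)
      ≈⟨ ∑-concatMap (partitions xs) _ _ ⟩
    ∑ (partitions xs) (λ ν → w [ x ] * ∏ ν w + ∑ (inserts x ν) (λ μ → ∏ μ w))
      ≈⟨ ∑-cong (partitions xs) (λ ν → +-cong refl (inserts-∏ x ν w)) ⟩
    ∑ (partitions xs) (λ ν → w [ x ] * ∏ ν w + proj₂ (D.∏ ν wε))
      ≈⟨ ∑-+ (partitions xs) _ _ ⟩
    ∑ (partitions xs) (λ ν → w [ x ] * ∏ ν w) + ∑ (partitions xs) (λ ν → proj₂ (D.∏ ν wε))
      ≈⟨ +-cong (sym (∑-*ˡ (partitions xs) _ _)) (sym (proj₂-partitionSum xs wε)) ⟩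
    w [ x ] * partitionSum S w xs + proj₂ (partitionSum (Dual S) wε xs) ∎
    where
    wε : List X → D.Carrier
    wε = < w , (λ b → w (x ∷ b)) >

  ∑-partitionSum-cons : ∀ (x : X) (τs : List (List X)) (w : List X → Carrier) →
    ∑ τs (λ τ → partitionSum S w (x ∷ τ))
      ≈ w [ x ] * ∑ τs (partitionSum S w)
        + proj₂ (D.∑ τs (partitionSum (Dual S) < w , (λ b → w (x ∷ b)) >))
  ∑-partitionSum-cons {X = X} x τs w = begin
    ∑ τs (λ τ → partitionSum S w (x ∷ τ))
      ≈⟨ ∑-cong τs (λ τ → partitionSum-cons x τ w) ⟩
    ∑ τs (λ τ → w [ x ] * partitionSum S w τ + proj₂ (partitionSum (Dual S) wε τ))
      ≈⟨ ∑-+ τs _ _ ⟩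
    ∑ τs (λ τ → w [ x ] * partitionSum S w τ) + ∑ τs (λ τ → proj₂ (partitionSum (Dual S) wε τ))
      ≈⟨ +-cong (sym (∑-*ˡ τs _ _)) (sym (proj₂-∑ τs _)) ⟩
    w [ x ] * ∑ τs (partitionSum S w) + proj₂ (D.∑ τs (partitionSum (Dual S) wε)) ∎
    where
    wε : List X → D.Carrier
    wε = < w , (λ b → w (x ∷ b)) >

  partitionSum-map : ∀ (f : A → B) (w : List B → Carrier) (l : List A) →
                     partitionSum S w (map f l) ≈ partitionSum S (λ b → w (map f b)) l
  partitionSum-map f w l = begin
    ∑ (partitions (map f l)) (λ ν → ∏ ν w)
      ≡⟨ ≡.cong (λ νs → ∑ νs (λ ν → ∏ ν w)) (partitions-map f l) ⟩
    ∑ (map (map (map f)) (partitions l)) (λ ν → ∏ ν w)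
      ≡⟨ ∑-map (partitions l) (map (map f)) _ ⟩
    ∑ (partitions l) (λ ν → ∏ (map (map f) ν) w)
      ≈⟨ ∑-cong (partitions l) (λ ν → reflexive (∏-map ν (map f) w)) ⟩
    partitionSum S (λ b → w (map f b)) l ∎

  partitionSum-cong : ∀ (l : List X) {w w′ : List X → Carrier} → (∀ b → w b ≈ w′ b) →
                      partitionSum S w l ≈ partitionSum S w′ l
  partitionSum-cong l w≈w′ = ∑-cong (partitions l) (λ ν → ∏-cong ν w≈w′)

  proj₂-∏-vanishing : ∀ (ν : List A) (f : A → D.Carrier) → All (λ b → proj₂ (f b) ≈ 0#) ν →
                      proj₂ (D.∏ ν f) ≈ 0#
  proj₂-∏-vanishing []      f []       = refl
  proj₂-∏-vanishing (b ∷ ν) f (h ∷ hs) =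
    trans (+-cong (trans (*-cong refl (proj₂-∏-vanishing ν f hs)) (zeroʳ _))
                  (trans (*-cong h refl) (zeroˡ _)))
          (+-identityˡ _)

  proj₂-∏-+ : ∀ (ν : List A) (f u v : A → Carrier) →
    proj₂ (D.∏ ν < f , (λ b → u b + v b) >) ≈ proj₂ (D.∏ ν < f , u >) + proj₂ (D.∏ ν < f , v >)
  proj₂-∏-+ []      f u v = sym (+-identityˡ _)
  proj₂-∏-+ {A = A} (b ∷ ν) f u v = begin
    f b * proj₂ (D.∏ ν < f , u+v >) + (u b + v b) * proj₁ (D.∏ ν < f , u+v >)
      ≈⟨ +-cong (*-cong refl (proj₂-∏-+ ν f u v)) (*-cong refl (proj₁-∏ ν _)) ⟩
    f b * (U + V) + (u b + v b) * ∏ ν f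
      ≈⟨ +-cong (distribˡ _ _ _) (distribʳ _ _ _) ⟩
    (f b * U + f b * V) + (u b * ∏ ν f + v b * ∏ ν f)
      ≈⟨ +-interchange _ _ _ _ ⟩
    (f b * U + u b * ∏ ν f) + (f b * V + v b * ∏ ν f)
      ≈⟨ sym (+-cong (+-cong refl (*-cong refl (proj₁-∏ ν _)))
                     (+-cong refl (*-cong refl (proj₁-∏ ν _)))) ⟩
    proj₂ (D.∏ (b ∷ ν) < f , u >) + proj₂ (D.∏ (b ∷ ν) < f , v >) ∎
    where
    u+v : A → Carrier
    u+v b = u b + v b
    U V : Carrier
    U = proj₂ (D.∏ ν < f , u >)
    V = proj₂ (D.∏ ν < f , v >)

  proj₂-∏-∑ : ∀ {T : Set a} (ts : List T) (ν : List A) (f : A → Carrier) (u : T → A → Carrier) →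
    proj₂ (D.∏ ν < f , (λ b → ∑ ts (λ t → u t b)) >) ≈ ∑ ts (λ t → proj₂ (D.∏ ν < f , u t >))
  proj₂-∏-∑ []       ν f u = proj₂-∏-vanishing ν _ (All.universal (λ _ → refl) ν)
  proj₂-∏-∑ (t ∷ ts) ν f u = trans (proj₂-∏-+ ν f (u t) _) (+-cong refl (proj₂-∏-∑ ts ν f u))

  proj₂-partitionSum-+ : ∀ (l : List X) (f u v : List X → Carrier) →
    proj₂ (partitionSum (Dual S) < f , (λ b → u b + v b) > l)
      ≈ proj₂ (partitionSum (Dual S) < f , u > l) + proj₂ (partitionSum (Dual S) < f , v > l)
  proj₂-partitionSum-+ l f u v = begin
    proj₂ (partitionSum (Dual S) _ l)
      ≈⟨ proj₂-partitionSum l _ ⟩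
    ∑ (partitions l) (λ ν → proj₂ (D.∏ ν _))
      ≈⟨ ∑-cong (partitions l) (λ ν → proj₂-∏-+ ν f u v) ⟩
    ∑ (partitions l) (λ ν → proj₂ (D.∏ ν < f , u >) + proj₂ (D.∏ ν < f , v >))
      ≈⟨ ∑-+ (partitions l) _ _ ⟩
    ∑ (partitions l) (λ ν → proj₂ (D.∏ ν < f , u >)) + ∑ (partitions l) (λ ν → proj₂ (D.∏ ν < f , v >))
      ≈⟨ sym (+-cong (proj₂-partitionSum l _) (proj₂-partitionSum l _)) ⟩
    proj₂ (partitionSum (Dual S) < f , u > l) + proj₂ (partitionSum (Dual S) < f , v > l) ∎

  proj₂-partitionSum-∑ : ∀ {T : Set a} (ts : List T) (l : List X) (f : List X → Carrier)
    (u : T → List X → Carrier) →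
    proj₂ (partitionSum (Dual S) < f , (λ b → ∑ ts (λ t → u t b)) > l)
      ≈ ∑ ts (λ t → proj₂ (partitionSum (Dual S) < f , u t > l))
  proj₂-partitionSum-∑ ts l f u = begin
    proj₂ (partitionSum (Dual S) _ l)
      ≈⟨ proj₂-partitionSum l _ ⟩
    ∑ (partitions l) (λ ν → proj₂ (D.∏ ν _))
      ≈⟨ ∑-cong (partitions l) (λ ν → proj₂-∏-∑ ts ν f u) ⟩
    ∑ (partitions l) (λ ν → ∑ ts (λ t → proj₂ (D.∏ ν < f , u t >)))
      ≈⟨ ∑-swap (partitions l) ts _ ⟩
    ∑ ts (λ t → ∑ (partitions l) (λ ν → proj₂ (D.∏ ν < f , u t >)))
      ≈⟨ ∑-cong ts (λ t → sym (proj₂-partitionSum l _)) ⟩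
    ∑ ts (λ t → proj₂ (partitionSum (Dual S) < f , u t > l)) ∎

open PartitionSums

-- Substitution: choosing an element of T y for every item y of ν and then
-- partitioning the chosen list is the same as partitioning ν and making
-- the choices blockwise.
partitionSum-choices : ∀ {c ℓ} (S : CommutativeSemiring c ℓ) → let open CommutativeSemiring S in
  ∀ (T : A → List B) (G : List B → Carrier) (ν : List A) →
  ListSums.∑ S (choices (map T ν)) (partitionSum S G)
    ≈ partitionSum S (λ b → ListSums.∑ S (choices (map T b)) G) ν
partitionSum-choices S T G []      = +-identityʳ _
  where open ListSums S
partitionSum-choices {A = A} {B = B} S T G (y ∷ ν) = begin
  ∑ (cartesianProductWith _∷_ (T y) (choices (map T ν))) (partitionSum S G)
    ≈⟨ ∑-cartesian _∷_ (T y) _ _ ⟩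
  ∑ (T y) (λ t → ∑ (choices (map T ν)) (λ τ → partitionSum S G (t ∷ τ)))
    ≈⟨ ∑-cong (T y) (λ t → ∑-partitionSum-cons S t (choices (map T ν)) G) ⟩
  ∑ (T y) (λ t → G [ t ] * ∑ (choices (map T ν)) (partitionSum S G)
               + proj₂ (D.∑ (choices (map T ν)) (partitionSum (Dual S) (Gε t))))
    ≈⟨ ∑-cong (T y) (λ t → +-cong (*-cong refl (partitionSum-choices S T G ν))
                                  (proj₂ (partitionSum-choices (Dual S) T (Gε t) ν))) ⟩
  ∑ (T y) (λ t → G [ t ] * partitionSum S H ν
               + proj₂ (partitionSum (Dual S) (λ b → D.∑ (choices (map T b)) (Gε t)) ν))
    ≈⟨ ∑-cong (T y) (λ t → +-cong refl (proj₂ (partitionSum-cong (Dual S) ν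
         (λ b → proj₁-∑ S (choices (map T b)) (Gε t) , proj₂-∑ S (choices (map T b)) (Gε t))))) ⟩
  ∑ (T y) (λ t → G [ t ] * partitionSum S H ν + proj₂ (partitionSum (Dual S) < H , K t > ν))
    ≈⟨ ∑-+ (T y) _ _ ⟩
  ∑ (T y) (λ t → G [ t ] * partitionSum S H ν)
    + ∑ (T y) (λ t → proj₂ (partitionSum (Dual S) < H , K t > ν))
    ≈⟨ +-cong (trans (sym (∑-*ʳ (T y) _ _)) (*-cong H[y] refl))
              (sym (proj₂-partitionSum-∑ S (T y) ν H K)) ⟩
  H [ y ] * partitionSum S H ν + proj₂ (partitionSum (Dual S) < H , (λ b → ∑ (T y) (λ t → K t b)) > ν)
    ≈⟨ +-cong refl (proj₂ (partitionSum-cong (Dual S) ν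
         (λ b → refl , sym (∑-cartesian _∷_ (T y) (choices (map T b)) G)))) ⟩
  H [ y ] * partitionSum S H ν + proj₂ (partitionSum (Dual S) < H , (λ b → H (y ∷ b)) > ν)
    ≈⟨ sym (partitionSum-cons S y ν H) ⟩
  partitionSum S H (y ∷ ν) ∎
  where
  open ListSums S
  module D = ListSums (Dual S)
  Gε : B → List B → D.Carrier
  Gε t = < G , (λ τ → G (t ∷ τ)) >
  H : List A → Carrier
  H b = ∑ (choices (map T b)) G
  K : B → List A → Carrier
  K t b = ∑ (choices (map T b)) (λ τ → G (t ∷ τ))
  H[y] : ∑ (T y) (λ t → G [ t ]) ≈ H [ y ]
  H[y] = trans (∑-cong (T y) (λ t → sym (+-identityʳ _))) (sym (∑-cartesian _∷_ (T y) (choices []) G))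

-- Second-order dual numbers Dual (Dual S): an element ((a , e) , (f , h))
-- stands for a + e ε₁ + f ε₂ + h ε₁ε₂.  Inserting an item into a
-- partition of a partition is a second derivative; the facts needed are
-- that exchanging ε₁ and ε₂ is multiplicative and that adding ε₁ε₂-terms
-- to the factors of a product changes only its ε₁ε₂-coefficient.
module SecondOrderDuals {c ℓ} (S : CommutativeSemiring c ℓ) where
  open ListSums S
  open import Algebra.Solver.Ring.NaturalCoefficients.Default S
    using (solve; _:=_; _:+_; _:*_; con)
  private
    module D  = ListSums (Dual S)
    module DD = ListSums (Dual (Dual S))

  base top : DD.Carrier → Carrier
  base x = proj₁ (proj₁ x)
  top  x = proj₂ (proj₂ x)

  swap : DD.Carrier → DD.Carrier
  swap ((a , e) , (f , h)) = ((a , f) , (e , h))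

  ε₁ε₂ : Carrier → DD.Carrier
  ε₁ε₂ z = ((0# , 0#) , (0# , z))

  swap-* : ∀ x y → swap (x DD.* y) DD.≈ swap x DD.* swap y
  swap-* ((a , e) , (f , h)) ((a′ , e′) , (f′ , h′)) =
    (refl , refl) , (refl , +-interchange (a * h′) (e * f′) (f * e′) (h * a′))

  swap-∏ : ∀ (ν : List A) (u : A → DD.Carrier) → DD.∏ ν (swap ∘′ u) DD.≈ swap (DD.∏ ν u)
  swap-∏ []      u = DD.refl
  swap-∏ (b ∷ ν) u = DD.trans (DD.*-cong DD.refl (swap-∏ ν u)) (DD.sym (swap-* (u b) (DD.∏ ν u)))

  swap-∑ : ∀ (ν : List A) (u : A → DD.Carrier) → DD.∑ ν (swap ∘′ u) DD.≈ swap (DD.∑ ν u)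
  swap-∑ []      u = DD.refl
  swap-∑ (b ∷ ν) u = DD.+-cong DD.refl (swap-∑ ν u)

  top-partitionSum-swap : ∀ (l : List X) (u : List X → DD.Carrier) →
    top (partitionSum (Dual (Dual S)) (swap ∘′ u) l) ≈ top (partitionSum (Dual (Dual S)) u l)
  top-partitionSum-swap l u = proj₂ (proj₂ (DD.trans (DD.∑-cong (partitions l) (λ ν → swap-∏ ν u))
                                                     (swap-∑ (partitions l) (λ ν → DD.∏ ν u))))

  base-∏ : ∀ (ν : List A) (u : A → DD.Carrier) → base (DD.∏ ν u) ≈ ∏ ν (base ∘′ u)
  base-∏ []      u = refl
  base-∏ (b ∷ ν) u = *-cong refl (base-∏ ν u)

  *-+ε₁ε₂ : ∀ (x y : DD.Carrier) (k K : Carrier) →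
    (x DD.+ ε₁ε₂ k) DD.* (y DD.+ ε₁ε₂ K) DD.≈ x DD.* y DD.+ ε₁ε₂ (base x * K + k * base y)
  *-+ε₁ε₂ ((a , e) , (f , h)) ((a′ , e′) , (f′ , h′)) k K =
    ( solve 2 (λ a a′ → (a :+ con 0) :* (a′ :+ con 0) := a :* a′ :+ con 0) refl a a′
    , solve 4 (λ a e a′ e′ → (a :+ con 0) :* (e′ :+ con 0) :+ (e :+ con 0) :* (a′ :+ con 0)
                           := (a :* e′ :+ e :* a′) :+ con 0) refl a e a′ e′ )
    , ( solve 4 (λ a f a′ f′ → (a :+ con 0) :* (f′ :+ con 0) :+ (f :+ con 0) :* (a′ :+ con 0)
                             := (a :* f′ :+ f :* a′) :+ con 0) refl a f a′ f′
      , solve 10 (λ a e f h a′ e′ f′ h′ k K →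
            ((a :+ con 0) :* (h′ :+ K) :+ (e :+ con 0) :* (f′ :+ con 0))
              :+ ((f :+ con 0) :* (e′ :+ con 0) :+ (h :+ k) :* (a′ :+ con 0))
            := ((a :* h′ :+ e :* f′) :+ (f :* e′ :+ h :* a′)) :+ (a :* K :+ k :* a′))
          refl a e f h a′ e′ f′ h′ k K )

  ∏-+ε₁ε₂ : ∀ (ν : List A) (u : A → DD.Carrier) (k : A → Carrier) →
    DD.∏ ν (λ b → u b DD.+ ε₁ε₂ (k b)) DD.≈ DD.∏ ν u DD.+ ε₁ε₂ (proj₂ (D.∏ ν < base ∘′ u , k >))
  ∏-+ε₁ε₂ []      u k =
    (sym (+-identityʳ _) , sym (+-identityʳ _)) , (sym (+-identityʳ _) , sym (+-identityʳ _))
  ∏-+ε₁ε₂ (b ∷ ν) u k = DD.trans (DD.*-cong DD.refl (∏-+ε₁ε₂ ν u k))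
    (DD.trans (*-+ε₁ε₂ (u b) (DD.∏ ν u) (k b) (proj₂ (D.∏ ν < base ∘′ u , k >)))
      (DD.+-cong DD.refl ((refl , refl) , (refl ,
        +-cong refl (*-cong refl (trans (base-∏ ν u) (sym (proj₁-∏ S ν _))))))))

  top-partitionSum-+ε₁ε₂ : ∀ (l : List X) (u : List X → DD.Carrier) (k : List X → Carrier) →
    top (partitionSum (Dual (Dual S)) (λ b → u b DD.+ ε₁ε₂ (k b)) l)
      ≈ top (partitionSum (Dual (Dual S)) u l) + proj₂ (partitionSum (Dual S) < base ∘′ u , k > l)
  top-partitionSum-+ε₁ε₂ {X = X} l u k =
    trans (proj₂ (proj₂ (DD.∑-cong (partitions l) (λ ν → ∏-+ε₁ε₂ ν u k))))
          (trans (top-∑ (partitions l)) (+-cong refl (sym (proj₂-partitionSum S l _))))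
    where
    firstOrder : List (List X) → Carrier
    firstOrder ν = proj₂ (D.∏ ν < base ∘′ u , k >)
    top-∑ : ∀ (νs : List (List (List X))) →
      top (DD.∑ νs (λ ν → DD.∏ ν u DD.+ ε₁ε₂ (firstOrder ν)))
        ≈ top (DD.∑ νs (λ ν → DD.∏ ν u)) + ∑ νs firstOrder
    top-∑ []       = sym (+-identityʳ _)
    top-∑ (ν ∷ νs) = trans (+-cong refl (top-∑ νs)) (+-interchange _ _ _ _)

open SecondOrderDuals using (swap; ε₁ε₂; top; top-partitionSum-swap; top-partitionSum-+ε₁ε₂)

-- Inserting x into one block of ν and then grouping the blocks of ν is the
-- same as grouping first and inserting x into a block of one group; the
-- ε-part records the group that receives x.
inserts-partitionSum : ∀ {c ℓ} (S : CommutativeSemiring c ℓ) → let open CommutativeSemiring S in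
  ∀ (x : X) (g : List (List X) → Carrier) (ν : List (List X)) →
  ListSums.∑ S (inserts x ν) (partitionSum S g)
    ≈ proj₂ (partitionSum (Dual S) < g , (λ μ → ListSums.∑ S (inserts x μ) g) > ν)
inserts-partitionSum S x g []      = sym (+-identityʳ _)
  where open ListSums S
inserts-partitionSum {X = X} S x g (b ∷ ν) = begin
  partitionSum S g ((x ∷ b) ∷ ν) + ∑ (map (b ∷_) (inserts x ν)) (partitionSum S g)
    ≈⟨ +-cong (partitionSum-cons S (x ∷ b) ν g) (reflexive (∑-map (inserts x ν) (b ∷_) _)) ⟩
  (g [ x ∷ b ] * partitionSum S g ν + B₁) + ∑ (inserts x ν) (λ μ → partitionSum S g (b ∷ μ))
    ≈⟨ +-cong refl (∑-partitionSum-cons S b (inserts x ν) g) ⟩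
  (g [ x ∷ b ] * partitionSum S g ν + B₁)
    + (g [ b ] * ∑ (inserts x ν) (partitionSum S g) + proj₂ (D.∑ (inserts x ν) (partitionSum (Dual S) gb)))
    ≈⟨ +-cong refl (+-cong (*-cong refl (inserts-partitionSum S x g ν))
                           (proj₂ (inserts-partitionSum (Dual S) x gb ν))) ⟩
  (g [ x ∷ b ] * partitionSum S g ν + B₁)
    + (g [ b ] * proj₂ (partitionSum (Dual S) gx ν) + top S (partitionSum (Dual (Dual S)) gbx ν))
    ≈⟨ rearrange _ _ _ _ ⟩
  (g [ b ] * proj₂ (partitionSum (Dual S) gx ν) + g [ x ∷ b ] * partitionSum S g ν)
    + (top S (partitionSum (Dual (Dual S)) gbx ν) + B₁)
    ≈⟨ +-cong (+-cong refl (*-cong (sym (+-identityʳ _)) (sym (proj₁-partitionSum S ν gx))))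
              (sym second-order) ⟩
  (g [ b ] * proj₂ (partitionSum (Dual S) gx ν) + ∑ (inserts x [ b ]) g * proj₁ (partitionSum (Dual S) gx ν))
    + top S (partitionSum (Dual (Dual S)) gxb ν)
    ≈⟨ sym (proj₂ (partitionSum-cons (Dual S) b ν gx)) ⟩
  proj₂ (partitionSum (Dual S) gx (b ∷ ν)) ∎
  where
  open ListSums S
  module D  = ListSums (Dual S)
  module DD = ListSums (Dual (Dual S))
  rearrange : ∀ p q r s → (p + q) + (r + s) ≈ (r + p) + (s + q)
  rearrange p q r s = trans (+-interchange p q r s) (+-cong (+-comm p r) (+-comm q s))
  -- dual weights recording: x inserted into a block of the group (gx);
  -- the block b joined to the group (gb); both, in either order (gbx, gxb)
  gx : List (List X) → D.Carrier
  gx = < g , (λ μ → ∑ (inserts x μ) g) >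
  gb : List (List X) → D.Carrier
  gb = < g , (λ μ → g (b ∷ μ)) >
  gbx : List (List X) → DD.Carrier
  gbx = < gb , (λ μ → D.∑ (inserts x μ) gb) >
  gxb : List (List X) → DD.Carrier
  gxb = < gx , (λ μ → gx (b ∷ μ)) >
  B₁ : Carrier
  B₁ = proj₂ (partitionSum (Dual S) < g , (λ μ → g ((x ∷ b) ∷ μ)) > ν)
  -- inserting x into b ∷ μ: either into b itself, or into μ with b kept
  gxb≈ : ∀ μ → gxb μ DD.≈ swap S (gbx μ) DD.+ ε₁ε₂ S (g ((x ∷ b) ∷ μ))
  gxb≈ μ = ( sym (+-identityʳ _) , trans (sym (proj₁-∑ S (inserts x μ) gb)) (sym (+-identityʳ _)) )
         , ( sym (+-identityʳ _)
           , trans (+-cong refl (reflexive (∑-map (inserts x μ) (b ∷_) g)))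
                   (trans (+-comm _ _) (+-cong (sym (proj₂-∑ S (inserts x μ) gb)) refl)) )
  second-order : top S (partitionSum (Dual (Dual S)) gxb ν)
                 ≈ top S (partitionSum (Dual (Dual S)) gbx ν) + B₁
  second-order = trans (partitionSum-cong (Dual (Dual S)) ν {gxb} gxb≈ .proj₂ .proj₂)
                       (trans (top-partitionSum-+ε₁ε₂ S ν (swap S ∘′ gbx) (λ μ → g ((x ∷ b) ∷ μ)))
                              (+-cong (top-partitionSum-swap S ν gbx) refl))

-- Composition of partitions: a partition of a partition of l is the same
-- as a partition of l into blocks C together with a partition of each C.
partitionSum-partitions : ∀ {c ℓ} (S : CommutativeSemiring c ℓ) → let open CommutativeSemiring S in
  ∀ (g : List (List X) → Carrier) (l : List X) →
  ListSums.∑ S (partitions l) (partitionSum S g)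
    ≈ partitionSum S (λ C → ListSums.∑ S (partitions C) g) l
partitionSum-partitions S g []       = +-identityʳ _
  where open ListSums S
partitionSum-partitions {X = X} S g (x ∷ xs) = begin
  ∑ (concatMap (λ ν → ([ x ] ∷ ν) ∷ inserts x ν) (partitions xs)) (partitionSum S g)
    ≈⟨ ∑-concatMap (partitions xs) _ _ ⟩
  ∑ (partitions xs) (λ ν → partitionSum S g ([ x ] ∷ ν) + ∑ (inserts x ν) (partitionSum S g))
    ≈⟨ ∑-cong (partitions xs)
         (λ ν → +-cong (partitionSum-cons S [ x ] ν g) (inserts-partitionSum S x g ν)) ⟩
  ∑ (partitions xs) (λ ν → (g [ [ x ] ] * partitionSum S g ν
                              + proj₂ (partitionSum (Dual S) < g , (λ μ → g ([ x ] ∷ μ)) > ν))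
                          + proj₂ (partitionSum (Dual S) < g , (λ μ → ∑ (inserts x μ) g) > ν))
    ≈⟨ ∑-cong (partitions xs) (λ ν → trans (+-assoc _ _ _)
         (+-cong refl (sym (proj₂-partitionSum-+ S ν g (λ μ → g ([ x ] ∷ μ)) (λ μ → ∑ (inserts x μ) g))))) ⟩
  ∑ (partitions xs) (λ ν → g [ [ x ] ] * partitionSum S g ν + proj₂ (partitionSum (Dual S) gx ν))
    ≈⟨ ∑-+ (partitions xs) _ _ ⟩
  ∑ (partitions xs) (λ ν → g [ [ x ] ] * partitionSum S g ν)
    + ∑ (partitions xs) (λ ν → proj₂ (partitionSum (Dual S) gx ν))
    ≈⟨ +-cong (sym (∑-*ˡ (partitions xs) _ _)) (sym (proj₂-∑ S (partitions xs) _)) ⟩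
  g [ [ x ] ] * ∑ (partitions xs) (partitionSum S g)
    + proj₂ (D.∑ (partitions xs) (partitionSum (Dual S) gx))
    ≈⟨ +-cong (*-cong (sym (+-identityʳ _)) (partitionSum-partitions S g xs))
              (proj₂ (partitionSum-partitions (Dual S) gx xs)) ⟩
  h [ x ] * partitionSum S h xs + proj₂ (partitionSum (Dual S) (λ C → D.∑ (partitions C) gx) xs)
    ≈⟨ +-cong refl (proj₂ (partitionSum-cong (Dual S) xs (λ C → proj₁-∑ S (partitions C) gx ,
          trans (proj₂-∑ S (partitions C) gx) (sym (∑-concatMap (partitions C) _ g))))) ⟩
  h [ x ] * partitionSum S h xs + proj₂ (partitionSum (Dual S) < h , (λ C → h (x ∷ C)) > xs)
    ≈⟨ sym (partitionSum-cons S x xs h) ⟩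
  partitionSum S h (x ∷ xs) ∎
  where
  open ListSums S
  module D = ListSums (Dual S)
  -- x as a new singleton block, or inserted into an existing block
  gx : List (List X) → D.Carrier
  gx = < g , (λ μ → g ([ x ] ∷ μ) + ∑ (inserts x μ) g) >
  h : List X → Carrier
  h C = ∑ (partitions C) g

partitionSum-++ : ∀ {c ℓ p} (S : CommutativeSemiring c ℓ) → let open CommutativeSemiring S in
  ∀ (P : X → Set p) (w : List X → Carrier) →
  (∀ C → Any P C → Any (λ x → ¬ P x) C → w C ≈ 0#) →
  ∀ (l₁ l₂ : List X) → All P l₁ → All (λ x → ¬ P x) l₂ →
  partitionSum S w (l₁ ++ l₂) ≈ partitionSum S w l₁ * partitionSum S w l₂
partitionSum-++ S P w mixed-vanish []        l₂ []         out =
  sym (trans (*-cong (+-identityʳ _) refl) (*-identityˡ _))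
  where open CommutativeSemiring S
partitionSum-++ {X = X} S P w mixed-vanish (x ∷ l₁) l₂ (px ∷ in₁) out = begin
  partitionSum S w (x ∷ (l₁ ++ l₂))
    ≈⟨ partitionSum-cons S x (l₁ ++ l₂) w ⟩
  w [ x ] * partitionSum S w (l₁ ++ l₂) + proj₂ (partitionSum (Dual S) wx (l₁ ++ l₂))
    ≈⟨ +-cong (*-cong refl (partitionSum-++ S P w mixed-vanish l₁ l₂ in₁ out))
              (proj₂ (partitionSum-++ (Dual S) P wx wx-mixed-vanish l₁ l₂ in₁ out)) ⟩
  w [ x ] * (partitionSum S w l₁ * partitionSum S w l₂) + (proj₁ W₁ * proj₂ W₂ + proj₂ W₁ * proj₁ W₂)
    ≈⟨ +-cong refl (+-cong (trans (*-cong refl W₂-ε) (zeroʳ _))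
                           (*-cong refl (proj₁-partitionSum S l₂ wx))) ⟩
  w [ x ] * (partitionSum S w l₁ * partitionSum S w l₂) + (0# + proj₂ W₁ * partitionSum S w l₂)
    ≈⟨ +-cong (sym (*-assoc _ _ _)) (+-identityˡ _) ⟩
  w [ x ] * partitionSum S w l₁ * partitionSum S w l₂ + proj₂ W₁ * partitionSum S w l₂
    ≈⟨ sym (distribʳ _ _ _) ⟩
  (w [ x ] * partitionSum S w l₁ + proj₂ W₁) * partitionSum S w l₂
    ≈⟨ *-cong (sym (partitionSum-cons S x l₁ w)) refl ⟩
  partitionSum S w (x ∷ l₁) * partitionSum S w l₂ ∎
  where
  open ListSums S
  module D = ListSums (Dual S)
  wx : List X → D.Carrier
  wx = < w , (λ b → w (x ∷ b)) >
  W₁ W₂ : D.Carrier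
  W₁ = partitionSum (Dual S) wx l₁
  W₂ = partitionSum (Dual S) wx l₂
  wx-mixed-vanish : ∀ C → Any P C → Any (λ x → ¬ P x) C → wx C D.≈ D.0#
  wx-mixed-vanish C inC outC = mixed-vanish C inC outC , mixed-vanish (x ∷ C) (there inC) (there outC)
  -- x cannot join a block of items outside P
  W₂-ε : proj₂ W₂ ≈ 0#
  W₂-ε = trans (proj₂-partitionSum S l₂ wx) (∑-zeroᴬ (All.map
    (λ {ν} blocks → proj₂-∏-vanishing S ν wx (All.map (λ { {y ∷ _} (_ , ¬py ∷ _) →
                      mixed-vanish (x ∷ y ∷ _) (here px) (there (here ¬py)) }) blocks))
    (partitions-QBlocks l₂ out)))

module CollapsingSums {c ℓ} (S : CommutativeSemiring c ℓ) where
  open ListSums S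

  oneBlock : ∀ (x : X) (xs : List X) (F : List (List X) → Carrier) →
             ∑ (partitions (x ∷ xs)) (λ ν → when (not (atLeastTwo ν)) (F ν)) ≈ F [ x ∷ xs ]
  oneBlock x []       F = +-identityʳ _
  oneBlock x (y ∷ ys) F = begin
    ∑ (concatMap (λ ν → ([ x ] ∷ ν) ∷ inserts x ν) (partitions (y ∷ ys)))
      (λ ν → when (not (atLeastTwo ν)) (F ν))
      ≈⟨ ∑-concatMap (partitions (y ∷ ys)) _ _ ⟩
    ∑ (partitions (y ∷ ys)) (λ ν → when (not (atLeastTwo ([ x ] ∷ ν))) (F ([ x ] ∷ ν))
                                    + ∑ (inserts x ν) (λ μ → when (not (atLeastTwo μ)) (F μ)))
      ≈⟨ ∑-congᴬ (All.map (λ {ν} ne → inserted ν ne) (partitions-nonempty y ys)) ⟩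
    ∑ (partitions (y ∷ ys)) (λ ν → when (not (atLeastTwo ν)) (∑ (inserts x ν) F))
      ≈⟨ oneBlock y ys (λ ν → ∑ (inserts x ν) F) ⟩
    F [ x ∷ y ∷ ys ] + 0#
      ≈⟨ +-identityʳ _ ⟩
    F [ x ∷ y ∷ ys ] ∎
    where
    -- x as a singleton block adds a second block; inserting it keeps the count
    inserted : ∀ ν → NonEmpty ν →
      when (not (atLeastTwo ([ x ] ∷ ν))) (F ([ x ] ∷ ν))
        + ∑ (inserts x ν) (λ μ → when (not (atLeastTwo μ)) (F μ))
        ≈ when (not (atLeastTwo ν)) (∑ (inserts x ν) F)
    inserted ν@(_ ∷ _) _ = trans (+-identityˡ _)
      (trans (∑-congᴬ (All.map (λ {μ} eq → reflexive (≡.cong (λ b → when (not b) (F μ)) eq))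
                               (inserts-atLeastTwo x ν)))
             (when-∑ (not (atLeastTwo ν)) (inserts x ν) F))

  singletonBlocks : ∀ (l : List X) (F : List (List X) → Carrier) →
                    ∑ (partitions l) (λ ν → when (allSingletons ν) (F ν)) ≈ F (map [_] l)
  singletonBlocks []       F = +-identityʳ _
  singletonBlocks (x ∷ xs) F = begin
    ∑ (concatMap (λ ν → ([ x ] ∷ ν) ∷ inserts x ν) (partitions xs)) (λ ν → when (allSingletons ν) (F ν))
      ≈⟨ ∑-concatMap (partitions xs) _ _ ⟩
    ∑ (partitions xs) (λ ν → when (allSingletons ν) (F ([ x ] ∷ ν))
                             + ∑ (inserts x ν) (λ μ → when (allSingletons μ) (F μ)))
      ≈⟨ ∑-congᴬ (All.map (λ {ν} ne → trans (+-cong refl (∑-zeroᴬ (All.map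
            (λ {μ} eq → reflexive (≡.cong (λ b → when b (F μ)) eq)) (inserts-notSingletons x ν ne))))
            (+-identityʳ _)) (partitions-nonemptyBlocks xs)) ⟩
    ∑ (partitions xs) (λ ν → when (allSingletons ν) (F ([ x ] ∷ ν)))
      ≈⟨ singletonBlocks xs (λ ν → F ([ x ] ∷ ν)) ⟩
    F ([ x ] ∷ map [_] xs) ∎

  leafChoices : ∀ (N : ℕ) (ν : List (List X)) → All NonEmpty ν → (φ : List (Tree X) → Carrier) →
    ∑ (choices (map (trees (suc N)) ν)) (λ d → when (all isLeaf d) (φ d))
      ≈ when (allSingletons ν) (φ (map leaf (heads ν)))
  leafChoices N []                  []       φ = +-identityʳ _
  leafChoices N ((z ∷ []) ∷ ν)      (_ ∷ ne) φ =
    trans (∑-cartesian _∷_ (leaf z ∷ []) (choices (map (trees (suc N)) ν)) _)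
          (trans (+-identityʳ _) (leafChoices N ν ne (λ d → φ (leaf z ∷ d))))
  leafChoices N ((z ∷ z′ ∷ r) ∷ ν) (_ ∷ ne) φ =
    trans (∑-cartesian _∷_ (trees (suc N) (z ∷ z′ ∷ r)) (choices (map (trees (suc N)) ν)) _)
      (∑-zeroᴬ (All.map (λ {t} notLeaf → ∑-zeroᴬ (All.universal
          (λ d → reflexive (≡.cong (λ b → when (b ∧ all isLeaf d) (φ (t ∷ d))) notLeaf))
          (choices (map (trees (suc N)) ν))))
        (trees-nodes (suc N) z z′ r)))

  ∏-blockwise : ∀ (l : List A) (e : A → Carrier) →
                All (λ μ → ∏ l e ≈ ∏ μ (λ d → ∏ d e)) (partitions l)
  ∏-blockwise []      e = refl ∷ []
  ∏-blockwise (t ∷ l) e = all-concatMap (All.map (λ {μ} h → *-cong (sym (*-identityʳ _)) h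
                            ∷ All.map (λ h′ → trans (*-cong refl h) (sym h′)) (inserted μ)) (∏-blockwise l e))
    where
    inserted : ∀ μ → All (λ μ′ → ∏ μ′ (λ d → ∏ d e) ≈ e t * ∏ μ (λ d → ∏ d e)) (inserts t μ)
    inserted []      = []
    inserted (d ∷ μ) =
      *-assoc _ _ _ ∷ map⁺ (All.map (λ h → trans (*-cong refl h) (x∙yz≈y∙xz _ _ _)) (inserted μ))

module _ {n : ℕ} {C : Set a} where

  twoDistinct-≢ : ∀ (i : Fin n) (ks : List (Fin n)) → Any (i ≢_) ks → twoDistinct {C = C} (i ∷ ks) ≡ true
  twoDistinct-≢ i ks differ = Equivalence.to T-≡ (any⁺ _ (Any.map fromWitnessFalse differ))

  twoDistinct-straddle : ∀ (j : Fin n) (is : List (Fin n)) → Any (_≡ j) is → Any (_≢ j) is →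
                         twoDistinct {C = C} is ≡ true
  twoDistinct-straddle j (i ∷ is) atJ offJ with i ≟ j
  ... | yes i≡j = twoDistinct-≢ i is
        (Any.map (λ k≢j i≡k → k≢j (≡.trans (≡.sym i≡k) i≡j)) (Any.tail (λ i≢j → i≢j i≡j) offJ))
  ... | no  i≢j = twoDistinct-≢ i is
        (Any.map (λ k≡j i≡k → i≢j (≡.trans i≡k k≡j)) (Any.tail i≢j atJ))

  twoDistinct-constant : ∀ (j : Fin n) (ks : List (Fin n)) → All (_≡ j) ks → twoDistinct {C = C} ks ≡ false
  twoDistinct-constant j []       _            = ≡.refl
  twoDistinct-constant j (k ∷ ks) (k≡j ∷ ks≡j) = noneDiffer ks ks≡j
    where
    noneDiffer : ∀ ks → All (_≡ j) ks → any (λ k′ → not ⌊ k ≟ k′ ⌋) ks ≡ false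
    noneDiffer []        _              = ≡.refl
    noneDiffer (k′ ∷ ks) (k′≡j ∷ ks≡j)
      rewrite ≡.trans (isYes≗does (k ≟ k′)) (dec-true (k ≟ k′) (≡.trans k≡j (≡.sym k′≡j))) = noneDiffer ks ks≡j

-- The algebra with two multiplications.  All sums and products below are
-- taken in the commutative semiring (𝒜, +, ·).
module TwoMultiplications {k kℓ m mℓ} (𝒜 : AlgebraWithTwoMultiplications k kℓ m mℓ) where
  open AlgebraWithTwoMultiplications 𝒜
  open Cumulants 𝒜

  ·-ring : CommutativeRing m mℓ
  ·-ring = record { isCommutativeRing = ·-isCommutativeRing }

  ·-semiring : CommutativeSemiring m mℓ
  ·-semiring = CommutativeRing.commutativeSemiring ·-ring

  open ListSums ·-semiring
  open CommutativeRing ·-ring using (-‿cong; -‿inverseʳ)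
  open import Algebra.Properties.Ring (CommutativeRing.ring ·-ring) using (-‿distribˡ-*)
  private module ∗ = IsCommutativeRing ∗-isCommutativeRing

  sumᴹ-map : ∀ (xs : List A) (f : A → Carrierᴹ) → sumᴹ (map f xs) ≡ ∑ xs f
  sumᴹ-map []       f = ≡.refl
  sumᴹ-map (x ∷ xs) f = ≡.cong (f x +ᴹ_) (sumᴹ-map xs f)

  prod·-map : ∀ (xs : List A) (f : A → Carrierᴹ) → prod· (map f xs) ≡ ∏ xs f
  prod·-map []       f = ≡.refl
  prod·-map (x ∷ xs) f = ≡.cong (f x ·_) (prod·-map xs f)

  prod·-tabulate : ∀ {n} (f : Fin n → Carrierᴹ) → prod· (tabulate f) ≡ ∏ (allFin n) f
  prod·-tabulate {n} f = ≡.trans (≡.cong prod· (≡.sym (map-tabulate id f))) (prod·-map (allFin n) f)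

  signed-cong : ∀ w {x y} → x ≈ y → signed w x ≈ signed w y
  signed-cong zero    x≈y = x≈y
  signed-cong (suc w) x≈y = -‿cong (signed-cong w x≈y)

  signed-· : ∀ w x y → signed w x · y ≈ signed w (x · y)
  signed-· zero    x y = refl
  signed-· (suc w) x y = trans (sym (-‿distribˡ-* _ _)) (-‿cong (signed-· w x y))

  signed-+ : ∀ v w x → signed (v ℕ.+ w) x ≡ signed v (signed w x)
  signed-+ zero    w x = ≡.refl
  signed-+ (suc v) w x = ≡.cong -ᴹ_ (signed-+ v w x)

  signed-1· : ∀ w x → signed w 1· · x ≈ signed w x
  signed-1· w x = trans (signed-· w 1· x) (signed-cong w (*-identityˡ x))

  module Cumulant (κ : List Carrierᴹ → Carrierᴹ) (isCumulant : IsCumulant κ) where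

    κ-singleton : ∀ y → κ [ y ] ≈ y
    κ-singleton y = sym (begin
      y                                                 ≈⟨ ∗.*-identityʳ y ⟨
      prod∗ [ y ]                                       ≈⟨ isCumulant [ y ] (s≤s z≤n) ⟩
      sumᴹ (map (λ ν → prod· (map κ ν)) [ [ [ y ] ] ]) ≈⟨ +-identityʳ _ ⟩
      κ [ y ] · 1·                                      ≈⟨ *-identityʳ _ ⟩
      κ [ y ]                                           ∎)

    moment-cumulant : ∀ (l : List Carrierᴹ) → 1 ≤ length l → prod∗ l ≈ partitionSum ·-semiring κ l
    moment-cumulant l len = begin
      prod∗ l                                             ≈⟨ isCumulant l len ⟩
      sumᴹ (map (λ ν → prod· (map κ ν)) (partitions l))  ≡⟨ sumᴹ-map (partitions l) _ ⟩
      ∑ (partitions l) (λ ν → prod· (map κ ν))            ≈⟨ ∑-cong (partitions l) (λ ν → reflexive (prod·-map ν κ)) ⟩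
      partitionSum ·-semiring κ l                         ∎

    module Items (n : ℕ) where

      Item : Set m
      Item = Fin n × Carrierᴹ

      blockWeight : List Item → Carrierᴹ
      blockWeight C = when (not (twoDistinct {C = Carrierᴹ} (map proj₁ C))) (κ (map proj₂ C))

      blockWeight-straddle : ∀ (j : Fin n) (C : List Item) → Any (λ x → proj₁ x ≡ j) C →
                             Any (λ x → ¬ proj₁ x ≡ j) C → blockWeight C ≈ 0ᴹ
      blockWeight-straddle j C atJ offJ = reflexive (≡.cong (λ b → when (not b) (κ (map proj₂ C)))
        (twoDistinct-straddle {C = Carrierᴹ} j (map proj₁ C) (Any-map⁺ atJ) (Any-map⁺ offJ)))

      partitionSum-oneMultiset : ∀ (j : Fin n) (a : List Carrierᴹ) → 1 ≤ length a →
                                 partitionSum ·-semiring blockWeight (map (j ,_) a) ≈ prod∗ a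
      partitionSum-oneMultiset j a len = begin
        partitionSum ·-semiring blockWeight (map (j ,_) a)
          ≈⟨ partitionSum-map ·-semiring (j ,_) blockWeight a ⟩
        partitionSum ·-semiring (λ b → blockWeight (map (j ,_) b)) a
          ≈⟨ partitionSum-cong ·-semiring a (λ b → reflexive (tagged b)) ⟩
        partitionSum ·-semiring κ a
          ≈⟨ moment-cumulant a len ⟨
        prod∗ a ∎
        where
        tagged : ∀ b → blockWeight (map (j ,_) b) ≡ κ b
        tagged b = ≡.cong₂ (λ t v → when (not t) (κ v))
          (twoDistinct-constant {C = Carrierᴹ} j (map proj₁ (map (j ,_) b))
                                (map⁺ (map⁺ (All.universal (λ _ → ≡.refl) b))))
          (≡.trans (≡.sym (map-∘ b)) (map-id b))

      itemsOf : (Fin n → List Carrierᴹ) → List (Fin n) → List Item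
      itemsOf A js = concatMap (λ i → map (i ,_) (A i)) js

      -- blocks meeting two multisets contribute 0, so the partition sum
      -- factors over the multisets
      partitionSum-itemsOf : ∀ (A : Fin n → List Carrierᴹ) (js : List (Fin n)) → Unique js →
        All (λ j → 1 ≤ length (A j)) js →
        partitionSum ·-semiring blockWeight (itemsOf A js) ≈ ∏ js (λ j → prod∗ (A j))
      partitionSum-itemsOf A []       _            _          = +-identityʳ _
      partitionSum-itemsOf A (j ∷ js) (j∉js ∷ uniq) (len ∷ lens) =
        trans (partitionSum-++ ·-semiring (λ x → proj₁ x ≡ j) blockWeight (blockWeight-straddle j)
                 (map (j ,_) (A j)) (itemsOf A js) atJ offJ)
              (*-cong (partitionSum-oneMultiset j (A j) len) (partitionSum-itemsOf A js uniq lens))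
        where
        atJ : All (λ x → proj₁ x ≡ j) (map (j ,_) (A j))
        atJ = map⁺ (All.universal (λ _ → ≡.refl) (A j))
        offJ : All (λ x → ¬ proj₁ x ≡ j) (itemsOf A js)
        offJ = all-concatMap (All.map (λ j≢i → map⁺ (All.universal (λ _ i≡j → j≢i (≡.sym i≡j)) _)) j∉js)

      signWeight : Tree Item → Carrierᴹ
      signWeight t = if mixingT t then signed (internal t) 1· else 0ᴹ

      ∏-signWeight : ∀ (F : List (Tree Item)) →
                     ∏ F signWeight ≈ (if mixingL F then signed (internalL F) 1· else 0ᴹ)
      ∏-signWeight []      = refl
      ∏-signWeight (t ∷ F) with mixingT t | mixingL F | ∏-signWeight F
      ... | true  | true  | ih = trans (*-cong refl ih) (trans (signed-1· (internal t) _)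
                                   (reflexive (≡.sym (signed-+ (internal t) (internalL F) 1·))))
      ... | true  | false | ih = trans (*-cong refl ih) (zeroʳ _)
      ... | false | _     | ih = zeroˡ _

      forestTerm : List (Tree Item) → Carrierᴹ
      forestTerm F = signed (wF F) (κF κ proj₂ F)

      mixingTerm : ∀ (F : List (Tree Item)) →
                   when (mixingL F) (forestTerm F) ≈ ∏ F signWeight · prod∗ (κL κ proj₂ F)
      mixingTerm F = trans (by-mixing (mixingL F)) (*-cong (sym (∏-signWeight F)) refl)
        where
        by-mixing : ∀ b → when b (forestTerm F)
                          ≈ (if b then signed (internalL F) 1· else 0ᴹ) · prod∗ (κL κ proj₂ F)
        by-mixing true  = sym (signed-1· (internalL F) _)
        by-mixing false = sym (zeroˡ _)

      -- the weight of a new vertex above the trees d, its own sign left out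
      childWeight : List (Tree Item) → Carrierᴹ
      childWeight d = ∏ d signWeight · κ (κL κ proj₂ d)

      κL-map : ∀ (d : List (Tree Item)) → κL κ proj₂ d ≡ map (κᵥ κ proj₂) d
      κL-map []      = ≡.refl
      κL-map (t ∷ d) = ≡.cong (κᵥ κ proj₂ t ∷_) (κL-map d)

      -- Expanding the ∗-product of the roots of a forest by the
      -- moment–cumulant formula groups its trees under new vertices.
      forest-expansion : ∀ (F : List (Tree Item)) → NonEmpty F →
                         ∏ F signWeight · prod∗ (κL κ proj₂ F) ≈ partitionSum ·-semiring childWeight F
      forest-expansion F@(_ ∷ _) _ = begin
        ∏ F signWeight · prod∗ (κL κ proj₂ F)
          ≈⟨ *-cong refl (moment-cumulant (κL κ proj₂ F) (s≤s z≤n)) ⟩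
        ∏ F signWeight · partitionSum ·-semiring κ (κL κ proj₂ F)
          ≡⟨ ≡.cong (λ v → ∏ F signWeight · partitionSum ·-semiring κ v) (κL-map F) ⟩
        ∏ F signWeight · partitionSum ·-semiring κ (map (κᵥ κ proj₂) F)
          ≈⟨ *-cong refl (partitionSum-map ·-semiring (κᵥ κ proj₂) κ F) ⟩
        ∏ F signWeight · ∑ (partitions F) (λ μ → ∏ μ (λ d → κ (map (κᵥ κ proj₂) d)))
          ≈⟨ ∑-*ˡ (partitions F) _ _ ⟩
        ∑ (partitions F) (λ μ → ∏ F signWeight · ∏ μ (λ d → κ (map (κᵥ κ proj₂) d)))
          ≈⟨ ∑-congᴬ (All.map (λ blockwise → *-cong blockwise refl) (∏-blockwise F signWeight)) ⟩
        ∑ (partitions F) (λ μ → ∏ μ (λ d → ∏ d signWeight) · ∏ μ (λ d → κ (map (κᵥ κ proj₂) d)))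
          ≈⟨ ∑-cong (partitions F) (λ μ → sym (∏-* μ _ _)) ⟩
        ∑ (partitions F) (λ μ → ∏ μ (λ d → ∏ d signWeight · κ (map (κᵥ κ proj₂) d)))
          ≈⟨ ∑-cong (partitions F) (λ μ → ∏-cong μ (λ d → reflexive
               (≡.cong (λ v → ∏ d signWeight · κ v) (≡.sym (κL-map d))))) ⟩
        partitionSum ·-semiring childWeight F ∎
        where open CollapsingSums ·-semiring using (∏-blockwise)

      leafWeight : List (Tree Item) → Carrierᴹ
      leafWeight d = when (not (twoDistinct {C = Carrierᴹ} (leafTags d))) (κ (κL κ proj₂ d))

      leaves-mixing : ∀ (d : List (Tree Item)) → all isLeaf d ≡ true → (mixingL d ≡ true) × (internalL d ≡ 0)
      leaves-mixing []           _  = ≡.refl , ≡.refl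
      leaves-mixing (leaf _ ∷ d) h  = leaves-mixing d h
      leaves-mixing (node _ ∷ d) ()

      cancel : ∀ (leaves distinct mixing : Bool) (i : ℕ) (K : Carrierᴹ) →
        (leaves ≡ true → (mixing ≡ true) × (i ≡ 0)) →
        (if mixing then signed i 1· else 0ᴹ) · K
          + (if (if leaves then distinct else mixing) then signed (suc i) 1· else 0ᴹ) · K
          ≈ when leaves (when (not distinct) K)
      cancel true  distinct mixing i K facts with facts ≡.refl
      cancel true  true     .true .0 K _ | ≡.refl , ≡.refl =
        trans (+-cong (*-identityˡ K) (trans (sym (-‿distribˡ-* 1· K)) (-‿cong (*-identityˡ K)))) (-‿inverseʳ K)
      cancel true  false    .true .0 K _ | ≡.refl , ≡.refl =
        trans (+-cong (*-identityˡ _) (zeroˡ _)) (+-identityʳ _)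
      cancel false distinct true  i K _ =
        trans (+-cong refl (sym (-‿distribˡ-* (signed i 1·) K))) (-‿inverseʳ (signed i 1· · K))
      cancel false distinct false i K _ = trans (+-cong (zeroˡ _) (zeroˡ _)) (+-identityˡ _)

      -- Putting a new root above the trees d reverses the sign, so the two
      -- contributions cancel, unless d consists of leaves from a single
      -- multiset: then the new root is not mixing and κ of the leaves remains.
      root-cancels : ∀ (d : List (Tree Item)) →
                     childWeight d + childWeight [ node d ] ≈ when (all isLeaf d) (leafWeight d)
      root-cancels d = trans
        (+-cong (*-cong (∏-signWeight d) refl) (*-cong (*-identityʳ (signWeight (node d))) (κ-singleton _)))
        (cancel (all isLeaf d) (twoDistinct {C = Carrierᴹ} (leafTags d)) (mixingL d) (internalL d) _
                (leaves-mixing d))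

      leafWeight-leaves : ∀ (C : List Item) → leafWeight (map leaf C) ≡ blockWeight C
      leafWeight-leaves C = ≡.cong₂ (λ tags vs → when (not (twoDistinct {C = Carrierᴹ} tags)) (κ vs))
                                    (tags C) (values C)
        where
        tags : ∀ C → leafTags (map leaf C) ≡ map proj₁ C
        tags []      = ≡.refl
        tags (x ∷ C) = ≡.cong (proj₁ x ∷_) (tags C)
        values : ∀ C → κL κ proj₂ (map leaf C) ≡ map proj₂ C
        values []      = ≡.refl
        values (x ∷ C) = ≡.cong (proj₂ x ∷_) (values C)

      -- Trees are enumerated with fuel suc N, enough for blocks of at most
      -- suc N items.
      module Blocks (N : ℕ) where

        treesOn : List Item → List (Tree Item)
        treesOn = trees (suc N)

        treeSum : List (List Item) → Carrierᴹ
        treeSum ν = ∑ (choices (map treesOn ν)) childWeight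

        rootedSum : List (List Item) → Carrierᴹ
        rootedSum ν = ∑ (choices (map treesOn ν)) (λ d → childWeight [ node d ])

        blockSum : List Item → Carrierᴹ
        blockSum C = ∑ (partitions C) treeSum

        treeSum-oneBlock : ∀ (x y : Item) (r : List Item) → length (x ∷ y ∷ r) ≤ suc N →
          treeSum [ x ∷ y ∷ r ] ≈ ∑ (partitions (x ∷ y ∷ r)) (λ ν → when (atLeastTwo ν) (rootedSum ν))
        treeSum-oneBlock x y r len = begin
          ∑ (cartesianProductWith _∷_ (treesOn C) [ [] ]) childWeight
            ≈⟨ ∑-cartesian _∷_ (treesOn C) [ [] ] childWeight ⟩
          ∑ (treesOn C) (λ t → childWeight [ t ] + 0ᴹ)
            ≈⟨ ∑-cong (treesOn C) (λ t → +-identityʳ _) ⟩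
          ∑ (treesOn C) (λ t → childWeight [ t ])
            ≡⟨ ≡.cong (λ ts → ∑ ts (λ t → childWeight [ t ]))
                      (trees-fuel (suc N) (suc (suc N)) C len (m≤n⇒m≤1+n len)) ⟩
          ∑ (trees (suc (suc N)) C) (λ t → childWeight [ t ])
            ≈⟨ ∑-concatMap (partitions C) _ _ ⟩
          ∑ (partitions C) (λ ν → ∑ (rootsOn ν) (λ t → childWeight [ t ]))
            ≈⟨ ∑-cong (partitions C) roots ⟩
          ∑ (partitions C) (λ ν → when (atLeastTwo ν) (rootedSum ν)) ∎
          where
          C : List Item
          C = x ∷ y ∷ r
          rootsOn : List (List Item) → List (Tree Item)
          rootsOn ν = if atLeastTwo ν then map node (choices (map treesOn ν)) else []
          roots : ∀ ν → ∑ (rootsOn ν) (λ t → childWeight [ t ]) ≈ when (atLeastTwo ν) (rootedSum ν)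
          roots ν with atLeastTwo ν
          ... | true  = reflexive (∑-map (choices (map treesOn ν)) node (λ t → childWeight [ t ]))
          ... | false = refl

        -- Summing over all reduced trees on a block, everything cancels
        -- except the block itself taken as singleton leaves.
        blockSum-blockWeight : ∀ (C : List Item) → NonEmpty C → length C ≤ suc N → blockSum C ≈ blockWeight C
        blockSum-blockWeight (x ∷ [])        _ _   =
          trans (+-identityʳ _) (trans (+-identityʳ _) (trans (*-cong (*-identityʳ _) refl) (*-identityˡ _)))
        blockSum-blockWeight C@(x ∷ y ∷ r) _ len = begin
          ∑ (partitions C) treeSum
            ≈⟨ ∑-cong (partitions C) (λ ν → when-split (atLeastTwo ν) (treeSum ν)) ⟩
          ∑ (partitions C) (λ ν → when (atLeastTwo ν) (treeSum ν) + when (not (atLeastTwo ν)) (treeSum ν))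
            ≈⟨ ∑-+ (partitions C) _ _ ⟩
          ∑ (partitions C) (λ ν → when (atLeastTwo ν) (treeSum ν))
            + ∑ (partitions C) (λ ν → when (not (atLeastTwo ν)) (treeSum ν))
            ≈⟨ +-cong refl (trans (oneBlock x (y ∷ r) treeSum) (treeSum-oneBlock x y r len)) ⟩
          ∑ (partitions C) (λ ν → when (atLeastTwo ν) (treeSum ν))
            + ∑ (partitions C) (λ ν → when (atLeastTwo ν) (rootedSum ν))
            ≈⟨ sym (∑-+ (partitions C) _ _) ⟩
          ∑ (partitions C) (λ ν → when (atLeastTwo ν) (treeSum ν) + when (atLeastTwo ν) (rootedSum ν))
            ≈⟨ ∑-cong (partitions C) (λ ν → trans (when-+ (atLeastTwo ν) _ _)
                                                  (when-cong (atLeastTwo ν) (cancelled ν))) ⟩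
          ∑ (partitions C) (λ ν → when (atLeastTwo ν) (leafSum ν))
            ≈⟨ ∑-congᴬ (All.map (λ {ν} ne → trans (when-cong (atLeastTwo ν) (leafChoices N ν ne leafWeight))
                                                  (when-comm (atLeastTwo ν) (allSingletons ν) _))
                                 (partitions-nonemptyBlocks C)) ⟩
          ∑ (partitions C) (λ ν → when (allSingletons ν) (when (atLeastTwo ν) (leafWeight (map leaf (heads ν)))))
            ≈⟨ singletonBlocks C (λ ν → when (atLeastTwo ν) (leafWeight (map leaf (heads ν)))) ⟩
          leafWeight (map leaf (heads (map [_] C)))
            ≡⟨ ≡.trans (≡.cong (λ l → leafWeight (map leaf l)) (heads-singletons C)) (leafWeight-leaves C) ⟩
          blockWeight C ∎
          where
          open CollapsingSums ·-semiring using (oneBlock; singletonBlocks; leafChoices)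
          leafSum : List (List Item) → Carrierᴹ
          leafSum ν = ∑ (choices (map treesOn ν)) (λ d → when (all isLeaf d) (leafWeight d))
          cancelled : ∀ ν → treeSum ν + rootedSum ν ≈ leafSum ν
          cancelled ν = trans (sym (∑-+ (choices (map treesOn ν)) _ _))
                              (∑-cong (choices (map treesOn ν)) root-cancels)

      ∑-keepIf : ∀ b (F : List (Tree Item)) →
                 ∑ (keepIf {n = n} {C = Carrierᴹ} b F) forestTerm ≈ when b (forestTerm F)
      ∑-keepIf true  F = +-identityʳ _
      ∑-keepIf false F = refl

      -- The right-hand side of the theorem is the partition sum of blockWeight:
      -- a forest is a partition into reduced trees; expanding the ∗-product
      -- of its roots regroups trees, and regrouping within a block cancels
      -- down to the block weight.
      forestSum : ∀ (l : List Item) → NonEmpty l →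
        sumᴹ (map forestTerm (mixingForests l)) ≈ partitionSum ·-semiring blockWeight l
      forestSum l@(x ∷ xs) _ = begin
        sumᴹ (map forestTerm (mixingForests l))
          ≡⟨ sumᴹ-map (mixingForests l) forestTerm ⟩
        ∑ (mixingForests l) forestTerm
          ≈⟨ ∑-concatMap (forests l) _ forestTerm ⟩
        ∑ (forests l) (λ F → ∑ (keepIf {n = n} {C = Carrierᴹ} (mixingL F) F) forestTerm)
          ≈⟨ ∑-cong (forests l) (λ F → trans (∑-keepIf (mixingL F) F) (mixingTerm F)) ⟩
        ∑ (forests l) (λ F → ∏ F signWeight · prod∗ (κL κ proj₂ F))
          ≈⟨ ∑-concatMap (partitions l) _ _ ⟩
        ∑ (partitions l) (λ ν → ∑ (choices (map treesOn ν)) (λ F → ∏ F signWeight · prod∗ (κL κ proj₂ F)))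
          ≈⟨ ∑-congᴬ (All.map (λ { {b ∷ ν} _ → ∑-congᴬ (All.map (λ {F} → forest-expansion F)
                                                                    (choices-nonempty (map treesOn (b ∷ ν)) tt)) })
                              (partitions-nonempty x xs)) ⟩
        ∑ (partitions l) (λ ν → ∑ (choices (map treesOn ν)) (partitionSum ·-semiring childWeight))
          ≈⟨ ∑-cong (partitions l) (partitionSum-choices ·-semiring treesOn childWeight) ⟩
        ∑ (partitions l) (partitionSum ·-semiring treeSum)
          ≈⟨ partitionSum-partitions ·-semiring treeSum l ⟩
        partitionSum ·-semiring blockSum l
          ≈⟨ ∑-congᴬ (All.map (λ {ν} (ne , sz) → ∏-congᴬ (All.zipWith
                (λ {C} (neC , C≤) → blockSum-blockWeight C neC (≡.subst (length C ≤_) sz C≤))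
                (ne , block-≤-size ν)))
                (All.zip (partitions-nonemptyBlocks l , partitions-size l))) ⟩
        partitionSum ·-semiring blockWeight l ∎
        where open Blocks (length xs)

      itemsOf-nonempty : ∀ (A : Fin n → List Carrierᴹ) (j : Fin n) (js : List (Fin n)) →
                         1 ≤ length (A j) → NonEmpty (itemsOf A (j ∷ js))
      itemsOf-nonempty A j js len = nonempty (A j) len
        where
        nonempty : ∀ a → 1 ≤ length a → NonEmpty (map (j ,_) a ++ itemsOf A js)
        nonempty (_ ∷ _) _ = tt

theorem1p6 : ∀ {k kℓ m mℓ} (𝒜 : AlgebraWithTwoMultiplications k kℓ m mℓ) →
    let open AlgebraWithTwoMultiplications 𝒜
        open Cumulants 𝒜
    in
    (κ : List Carrierᴹ → Carrierᴹ) → IsCumulant κ →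
    (n : ℕ) → 1 ≤ n → (A : Fin n → List Carrierᴹ) → (∀ i → 1 ≤ length (A i)) →
    prod· (tabulate (λ i → prod∗ (A i)))
      ≈ᴹ sumᴹ (map (λ F → signed (wF F) (κF κ proj₂ F)) (mixingForests (items A)))
theorem1p6 𝒜 κ isCumulant (suc n) (s≤s z≤n) A nonempty = begin
  prod· (tabulate (λ i → prod∗ (A i)))
    ≡⟨ prod·-tabulate (λ i → prod∗ (A i)) ⟩
  ∏ (allFin (suc n)) (λ i → prod∗ (A i))
    ≈⟨ partitionSum-itemsOf A (allFin (suc n)) (allFin⁺ (suc n)) (All.universal nonempty (allFin (suc n))) ⟨
  partitionSum ·-semiring blockWeight (items A)
    ≈⟨ forestSum (items A) (itemsOf-nonempty A Fin.zero (tabulate Fin.suc) (nonempty Fin.zero)) ⟨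
  sumᴹ (map forestTerm (mixingForests (items A))) ∎
  where
  open AlgebraWithTwoMultiplications 𝒜
  open Cumulants 𝒜
  open TwoMultiplications 𝒜
  open ListSums ·-semiring
  open Cumulant κ isCumulant
  open Items (suc n)
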